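{- Let $q$ be an odd prime power, $G=\left\{\left(\begin{smallmatrix}1&x&z\\0&1&y\\0&0&1\end{smallmatrix}\right):x,y,z\in\mathbb{F}_q\right\}$, $Z=Z(G)$, $\varepsilon\in\mathbb{F}_q$ a nonsquare, and $K=\{\varphi_{\alpha,\beta}:(\alpha,\beta)\in\mathbb{F}_q^2\setminus\{(0,0)\}\}\leq\operatorname{Aut}(G)$ with $$\varphi_{\alpha,\beta}\left(\left(\begin{smallmatrix}1&x&z\\0&1&y\\0&0&1\end{smallmatrix}\right)\right)=\left(\begin{smallmatrix}1&\alpha x+\varepsilon\beta y&\alpha\beta(\frac{x^2}{2}+\varepsilon\frac{y^2}{2})+\varepsilon\beta^2xy+(\alpha^2-\varepsilon\beta^2)z\\0&1&\beta x+\alpha y\\0&0&1\end{smallmatrix}\right).$$ For $i\in\mathbb{F}_q$ let $X_i=Y_i\cup\{e\}$, where $Y_i$ is the $K$-orbit of $\left(\begin{smallmatrix}1&1&i\\0&1&0\\0&0&1\end{smallmatrix}\right)$. Then there is a nonsquare $\delta\in\mathbb{F}_q$ such that $\mathcal{L}=\{X_i:i\in\mathbb{F}_q\}$ is a closed linked system of semiregular relative difference sets in $G$ with forbidden subgroup $Z$, parameters $(q^2,q,q^2,q,q,1,q+1)$, and pair of characteristic functions $(\chi,\psi)$, where $\chi(i)=-i$ and $\psi(i,j)=\frac{ij+\delta}{i+j}$.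
   Context: For $X\subseteq G$, $\underline{X}=\sum_{x\in X}x\in\mathbb{Z}G$, $X^{(-1)}=\{x^{ -1}:x\in X\}$, $e$ the identity. For $N\leq G$, $X$ is a relative difference set (RDS) relative to $N$ with parameters $(m,n,k,\lambda)$ if $\underline{X}\cdot\underline{X^{(-1)}}=ke+\lambda(\underline{G}-\underline{N})$, $k=|X|$, $m=|G:N|$, $n=|N|$, $\lambda>0$; semiregular: $|X\cap Ng|=1$ for all $g$. A collection $\{X_\alpha:\alpha\in S\}$ of RDSs with common forbidden subgroup $N$ and parameters $(m,n,k,\lambda)$, $|S|=s\geq2$, is a closed linked system with parameters $(m,n,k,\lambda,s,\mu,\nu)$ and pair of characteristic functions $(\chi,\psi)$ if $\chi:S\to S$ is a bijection, $\psi:(S\times S)\setminus\{(\alpha,\chi(\alpha))\}\to S$, $\mu,\nu\geq0$ integers, $X_\alpha^{(-1)}=X_{\chi(\alpha)}$, $\underline{X_\alpha}\cdot\underline{X_\beta}=ke+\lambda(\underline{G}-\underline{N})$ if $\beta=\chi(\alpha)$, and $\underline{X_\alpha}\cdot\underline{X_\beta}=\mu\underline{X_{\psi(\alpha,\beta)}}+\nu(\underline{G}-\underline{X_{\psi(\alpha,\beta)}})$ otherwise. -}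

module Defs where

open import Level using (0ℓ)
open import Algebra.Bundles using (CommutativeRing)
open import Data.Bool using (Bool; true; false; _∧_; _∨_; not; if_then_else_; T)
open import Data.Nat using (ℕ; zero; suc; _<_; _≤_) renaming (_+_ to _+ℕ_; _*_ to _*ℕ_)
open import Relation.Binary.PropositionalEquality using (_≡_)
open import Data.Product using (_×_; _,_; ∃; proj₁; proj₂)
open import Data.List using (List; []; _∷_; length; map; concatMap; any; filter)
open import Data.List.Relation.Unary.Any using (Any)
open import Data.List.Relation.Unary.AllPairs using (AllPairs)
open import Relation.Nullary using (¬_; does)
open import Relation.Binary using (Decidable)

record FiniteField : Set₁ where
  field
    ring : CommutativeRing 0ℓ 0ℓ
  open CommutativeRing ring public hiding (ring)
  field
    _≟_      : Decidable _≈_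
    1≉0      : ¬ (1# ≈ 0#)
    inverse  : ∀ x → ¬ (x ≈ 0#) → ∃ λ y → x * y ≈ 1#
    elems    : List Carrier
    complete : ∀ x → Any (x ≈_) elems
    distinct : AllPairs (λ a b → ¬ (a ≈ b)) elems

  order : ℕ
  order = length elems

  _==_ : Carrier → Carrier → Bool
  a == b = does (a ≟ b)

  -- the multiplicative inverse x⁻¹ of a nonzero x, found by search in
  -- the enumeration (its value at 0 is irrelevant and is 0)
  recip : Carrier → Carrier
  recip x = go elems
    where
    go : List Carrier → Carrier
    go []       = 0#
    go (y ∷ ys) = if (x * y) == 1# then y else go ys

  -- odd characteristic (equivalently, q odd)
  OddChar : Set
  OddChar = ¬ (1# + 1# ≈ 0#)

  IsNonsquare : Carrier → Set
  IsNonsquare a = ∀ y → ¬ (y * y ≈ a)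

count : {A : Set} → List A → (A → Bool) → ℕ
count []       p = 0
count (a ∷ as) p = if p a then suc (count as p) else count as p

anyL : {A : Set} → List A → (A → Bool) → Bool
anyL []       p = false
anyL (a ∷ as) p = p a ∨ anyL as p

allL : {A : Set} → List A → (A → Bool) → Bool
allL []       p = true
allL (a ∷ as) p = p a ∧ allL as p

module Heisenberg (F : FiniteField) where
  open FiniteField F

  -- The upper unitriangular matrix  [[1,x,z],[0,1,y],[0,0,1]]
  -- is represented by the triple (x , y , z).
  G : Set
  G = Carrier × Carrier × Carrier

  _·_ : G → G → G
  (x , y , z) · (x' , y' , z') = (x + x' , y + y' , z + z' + x * y')

  e : G
  e = (0# , 0# , 0#)

  inv : G → G
  inv (x , y , z) = (- x , - y , - z + x * y)

  _=G_ : G → G → Bool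
  (x , y , z) =G (x' , y' , z') = (x == x') ∧ (y == y') ∧ (z == z')

  elemsG : List G
  elemsG = concatMap (λ x → concatMap (λ y → map (λ z → (x , y , z)) elems) elems) elems

  Subset : Set
  Subset = G → Bool

  Zc : Subset
  Zc g = allL elemsG (λ h → (g · h) =G (h · g))

  size : Subset → ℕ
  size X = count elemsG X

  inverseSet : Subset → Subset
  inverseSet X g = X (inv g)

  -- coefficient of g in the group-ring product  X̲ · Y̲ :
  --   #{ (a , b) ∈ X × Y : a · b = g }
  prodCoeff : Subset → Subset → G → ℕ
  prodCoeff X Y g = sumL elemsG
    where
    sumL : List G → ℕ
    sumL []       = 0
    sumL (a ∷ as) = count elemsG (λ b → X a ∧ Y b ∧ ((a · b) =G g)) +ℕ sumL as

  -- X is a relative difference set relative to N with parameters (m,n,k,λ):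
  --   |G:N| = m, |N| = n, |X| = k, λ > 0 and
  --   X̲ · X̲^(-1) = k e + λ (G̲ - N̲)
  IsRDS : Subset → Subset → ℕ → ℕ → ℕ → ℕ → Set
  IsRDS X N m n k lam =
      (m *ℕ n ≡ size (λ _ → true))
    × (size N ≡ n)
    × (size X ≡ k)
    × (0 < lam)
    × (∀ g → prodCoeff X (inverseSet X) g
               ≡ (if g =G e then k else 0) +ℕ (if N g then 0 else lam))

  Semiregular : Subset → Subset → Set
  Semiregular X N = ∀ g → count elemsG (λ h → X h ∧ N (h · inv g)) ≡ 1

  -- The automorphism φ_{α,β} (depending on the nonsquare ε and h = 1/2)
  φ : (ε h α β : Carrier) → G → G
  φ ε h α β (x , y , z) =
    ( α * x + ε * β * y
    , β * x + α * y
    , α * β * (x * x * h + ε * (y * y * h)) + ε * (β * β) * (x * y)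
        + (α * α - ε * (β * β)) * z )

  Yorb : (ε h i : Carrier) → Subset
  Yorb ε h i g = anyL elems (λ α → anyL elems (λ β →
                   not ((α == 0#) ∧ (β == 0#)) ∧ (φ ε h α β (1# , 0# , i) =G g)))

  Xset : (ε h i : Carrier) → Subset
  Xset ε h i g = Yorb ε h i g ∨ (g =G e)

  _≐_ : Subset → Subset → Set
  X ≐ Y = ∀ g → X g ≡ Y g

  -- A closed linked system {X_α : α ∈ S} of RDSs with forbidden subgroup N,
  -- parameters (m,n,k,λ,s,μ,ν) and characteristic functions (χ,ψ);
  -- here the index set is S = the field itself (with equality _≈_).
  -- ψ is given as a total function but is only used on pairs (α,β) with
  -- β ≠ χ(α), i.e. on its domain of definition.
  IsClosedLinkedSystem : (Carrier → Subset) → Subset →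
                         (m n k lam s μ ν : ℕ) →
                         (χ : Carrier → Carrier) → (ψ : Carrier → Carrier → Carrier) → Set
  IsClosedLinkedSystem Xs N m n k lam s μ ν χ ψ =
      (order ≡ s) × (2 ≤ s)
    × (∀ α → IsRDS (Xs α) N m n k lam)
    × ((∀ α β → χ α ≈ χ β → α ≈ β) × (∀ β → ∃ λ α → χ α ≈ β))
    × (∀ α → inverseSet (Xs α) ≐ Xs (χ α))
    × (∀ α β → β ≈ χ α → ∀ g →
         prodCoeff (Xs α) (Xs β) g ≡ (if g =G e then k else 0) +ℕ (if N g then 0 else lam))
    × (∀ α β → ¬ (β ≈ χ α) → ∀ g →
         prodCoeff (Xs α) (Xs β) g ≡ (if Xs (ψ α β) g then μ else ν))

-- X_i is the graph z = f_i(x, y) := xy/2 + i N(x, y) of a function F² → F, where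
-- N(a, b) = a² - ε b² is the norm form of F(√ε): indeed φ_{α,β} maps (1, 0, i) to
-- (α, β, f_i(α, β)).  Such graphs are semiregular relative to Z = {(0, 0, z)}, and the
-- number of ways to write g = a b with a ∈ X_i, b ∈ X_j is the number of (a₁, a₂) ∈ F²
-- with (i + j) N(a₁, a₂) + L₁ a₁ + L₂ a₂ + C₀ = g₃, for L₁, L₂, C₀ depending on j and g.
-- For j = -i the equation is affine, and as ε is a nonsquare its linear part vanishes
-- only for g ∈ Z; this gives the counts q², 0 and q of a relative difference set.
-- Otherwise completing the square turns it into N(u, v) = T, which has one solution for
-- T = 0 and q + 1 solutions otherwise, as N is anisotropic, multiplicative and onto F^×.
-- With δ = h⁴/ε for h = 1/2, T vanishes exactly when g ∈ X_k for k = (ij + δ)/(i + j).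

module Submission where

open import Defs
open import Algebra.Bundles using (CommutativeRing)
import Algebra.Solver.Ring.AlmostCommutativeRing as ACR
open import Data.Bool using (Bool; true; false; _∧_; _∨_; not; if_then_else_)
open import Data.Bool.Properties using (∧-identityʳ)
open import Data.Empty using (⊥-elim)
open import Data.Integer as ℤ using (ℤ; +_; -[1+_]; _⊖_)
import Data.Integer.Properties as ℤ
open import Data.List using (List; []; _∷_; length; map; concatMap; _++_)
open import Data.List.Relation.Unary.All as All using (All; []; _∷_)
open import Data.List.Relation.Unary.AllPairs using (AllPairs; []; _∷_)
open import Data.List.Relation.Unary.Any as Any using (Any; here; there)
import Data.List.Relation.Unary.Any.Properties as Any
open import Data.Maybe as Maybe using (Maybe)
open import Data.Nat as ℕ using (ℕ; zero; suc; _^_) renaming (_+_ to _+ℕ_; _*_ to _*ℕ_)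
import Data.Nat.Properties as ℕ
open import Data.Nat.Tactic.RingSolver using (solve-∀)
open import Data.Product using (_×_; _,_; ∃; ∃₂; proj₁; proj₂; uncurry)
open import Data.Product.Relation.Binary.Pointwise.NonDependent using (_×ₛ_)
open import Data.Sign as Sign using (Sign)
open import Data.Sum using (_⊎_; inj₁; inj₂; [_,_]′)
open import Function using (_∘_)
open import Function.Bundles using (_⇔_; mk⇔; Equivalence)
open import Relation.Binary using (Setoid; _Preserves_⟶_; _Preserves₂_⟶_⟶_)
open import Relation.Binary.Consequences using (dec⇒weaklyDec)
open import Relation.Binary.PropositionalEquality as ≡ using (_≡_; cong; cong₂)
import Relation.Binary.Reasoning.Setoid
open import Relation.Nullary using (¬_; yes; no)

module IntegerCoefficientSolver {c ℓ} (R : CommutativeRing c ℓ) where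

  open CommutativeRing R
  open import Algebra.Properties.Ring ring
  -- With this multiplication 1 ×′ 1# and 2 ×′ 1# reduce to 1# and 1# + 1#, so the
  -- solver's constants con (+ 1) and con (+ 2) match 1# and 1# + 1# in goals.
  open import Algebra.Properties.Semiring.Mult.TCOptimised semiring renaming (_×_ to _×′_)
  open import Relation.Binary.Reasoning.Setoid setoid

  signed : Sign → Carrier → Carrier
  signed Sign.+ x = x
  signed Sign.- x = - x

  signed-cong : ∀ s {x y} → x ≈ y → signed s x ≈ signed s y
  signed-cong Sign.+ p = p
  signed-cong Sign.- p = -‿cong p

  signed-* : ∀ s t x y → signed (s Sign.* t) (x * y) ≈ signed s x * signed t y
  signed-* Sign.+ Sign.+ x y = refl
  signed-* Sign.+ Sign.- x y = -‿distribʳ-* x y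
  signed-* Sign.- Sign.+ x y = -‿distribˡ-* x y
  signed-* Sign.- Sign.- x y = begin
    x * y         ≈⟨ -‿involutive (x * y) ⟨
    - - (x * y)   ≈⟨ -‿cong (-‿distribʳ-* x y) ⟩
    - (x * - y)   ≈⟨ -‿distribˡ-* x (- y) ⟩
    - x * - y     ∎

  ⟦_⟧ℤ : ℤ → Carrier
  ⟦ + n ⟧ℤ      = n ×′ 1#
  ⟦ -[1+ n ] ⟧ℤ = - (suc n ×′ 1#)

  ⟦⟧-sign-abs : ∀ i → ⟦ i ⟧ℤ ≈ signed (ℤ.sign i) (ℤ.∣ i ∣ ×′ 1#)
  ⟦⟧-sign-abs (+ n)      = refl
  ⟦⟧-sign-abs -[1+ n ]  = refl

  ⟦⟧-◃ : ∀ s n → ⟦ s ℤ.◃ n ⟧ℤ ≈ signed s (n ×′ 1#)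
  ⟦⟧-◃ Sign.+ zero    = refl
  ⟦⟧-◃ Sign.+ (suc n) = refl
  ⟦⟧-◃ Sign.- zero    = sym -0#≈0#
  ⟦⟧-◃ Sign.- (suc n) = refl

  ⟦⟧-⊖ : ∀ m n → ⟦ m ⊖ n ⟧ℤ ≈ m ×′ 1# - n ×′ 1#
  ⟦⟧-⊖ zero    zero    = sym (-‿inverseʳ 0#)
  ⟦⟧-⊖ zero    (suc n) = sym (+-identityˡ _)
  ⟦⟧-⊖ (suc m) zero    = sym (trans (+-congˡ -0#≈0#) (+-identityʳ _))
  ⟦⟧-⊖ (suc m) (suc n) = begin
    ⟦ suc m ⊖ suc n ⟧ℤ                   ≡⟨ ≡.cong ⟦_⟧ℤ (ℤ.[1+m]⊖[1+n]≡m⊖n m n) ⟩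
    ⟦ m ⊖ n ⟧ℤ                           ≈⟨ ⟦⟧-⊖ m n ⟩
    m ×′ 1# - n ×′ 1#                    ≈⟨ +-congʳ (+-identityˡ _) ⟨
    (0# + m ×′ 1#) - n ×′ 1#             ≈⟨ +-congʳ (+-congʳ (-‿inverseʳ 1#)) ⟨
    ((1# - 1#) + m ×′ 1#) - n ×′ 1#      ≈⟨ +-congʳ (+-assoc 1# (- 1#) _) ⟩
    (1# + (- 1# + m ×′ 1#)) - n ×′ 1#    ≈⟨ +-congʳ (+-congˡ (+-comm (- 1#) _)) ⟩
    (1# + (m ×′ 1# - 1#)) - n ×′ 1#      ≈⟨ +-congʳ (+-assoc 1# _ _) ⟨
    (1# + m ×′ 1#) - 1# - n ×′ 1#        ≈⟨ +-assoc _ (- 1#) _ ⟩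
    (1# + m ×′ 1#) + (- 1# - n ×′ 1#)    ≈⟨ +-cong (1+× m 1#) (trans (-‿cong (1+× n 1#)) (sym (-‿+-comm 1# (n ×′ 1#)))) ⟨
    suc m ×′ 1# - suc n ×′ 1#            ∎

  ⟦⟧-+ : ∀ i j → ⟦ i ℤ.+ j ⟧ℤ ≈ ⟦ i ⟧ℤ + ⟦ j ⟧ℤ
  ⟦⟧-+ (+ m)      (+ n)      = ×-homo-+ 1# m n
  ⟦⟧-+ (+ m)      -[1+ n ]  = ⟦⟧-⊖ m (suc n)
  ⟦⟧-+ -[1+ m ]  (+ n)      = trans (⟦⟧-⊖ n (suc m)) (+-comm _ _)
  ⟦⟧-+ -[1+ m ]  -[1+ n ]  = begin
    - (suc (suc (m ℕ.+ n)) ×′ 1#)    ≡⟨ ≡.cong (λ k → - (suc k ×′ 1#)) (ℕ.+-suc m n) ⟨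
    - ((suc m ℕ.+ suc n) ×′ 1#)      ≈⟨ -‿cong (×-homo-+ 1# (suc m) (suc n)) ⟩
    - (suc m ×′ 1# + suc n ×′ 1#)    ≈⟨ -‿+-comm _ _ ⟨
    - (suc m ×′ 1#) - suc n ×′ 1#    ∎

  ⟦⟧-* : ∀ i j → ⟦ i ℤ.* j ⟧ℤ ≈ ⟦ i ⟧ℤ * ⟦ j ⟧ℤ
  ⟦⟧-* i j = begin
    ⟦ i ℤ.* j ⟧ℤ                                       ≈⟨ ⟦⟧-◃ (s Sign.* t) (ℤ.∣ i ∣ ℕ.* ℤ.∣ j ∣) ⟩
    signed (s Sign.* t) ((ℤ.∣ i ∣ ℕ.* ℤ.∣ j ∣) ×′ 1#)   ≈⟨ signed-cong (s Sign.* t) (×1-homo-* ℤ.∣ i ∣ ℤ.∣ j ∣) ⟩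
    signed (s Sign.* t) (∣i∣ * ∣j∣)                    ≈⟨ signed-* s t ∣i∣ ∣j∣ ⟩
    signed s ∣i∣ * signed t ∣j∣                        ≈⟨ *-cong (⟦⟧-sign-abs i) (⟦⟧-sign-abs j) ⟨
    ⟦ i ⟧ℤ * ⟦ j ⟧ℤ                                    ∎
    where
    s = ℤ.sign i
    t = ℤ.sign j
    ∣i∣ = ℤ.∣ i ∣ ×′ 1#
    ∣j∣ = ℤ.∣ j ∣ ×′ 1#

  ⟦⟧-neg : ∀ i → ⟦ ℤ.- i ⟧ℤ ≈ - ⟦ i ⟧ℤ
  ⟦⟧-neg (+ zero)   = sym -0#≈0#
  ⟦⟧-neg (+ suc n)  = refl
  ⟦⟧-neg -[1+ n ]   = sym (-‿involutive _)

  almostCommutativeRing : ACR.AlmostCommutativeRing c ℓ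
  almostCommutativeRing = ACR.fromCommutativeRing R

  ℤ-homomorphism : ℤ.+-*-rawRing ACR.-Raw-AlmostCommutative⟶ almostCommutativeRing
  ℤ-homomorphism = record
    { ⟦_⟧ = ⟦_⟧ℤ ; +-homo = ⟦⟧-+ ; *-homo = ⟦⟧-* ; -‿homo = ⟦⟧-neg
    ; 0-homo = refl ; 1-homo = refl }

  ⟦⟧-≟ : ∀ i j → Maybe (⟦ i ⟧ℤ ≈ ⟦ j ⟧ℤ)
  ⟦⟧-≟ i j = Maybe.map (λ { ≡.refl → refl }) (dec⇒weaklyDec ℤ._≟_ i j)

  open import Algebra.Solver.Ring ℤ.+-*-rawRing almostCommutativeRing ℤ-homomorphism ⟦⟧-≟ public

⟦_⟧ᵇ : Bool → ℕ
⟦ true ⟧ᵇ  = 1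
⟦ false ⟧ᵇ = 0

⟦∧⟧ᵇ : ∀ a b → ⟦ a ∧ b ⟧ᵇ ≡ ⟦ a ⟧ᵇ *ℕ ⟦ b ⟧ᵇ
⟦∧⟧ᵇ true  b = ≡.sym (ℕ.+-identityʳ _)
⟦∧⟧ᵇ false b = ≡.refl

bool-ext : ∀ {a b : Bool} → (a ≡ true → b ≡ true) → (b ≡ true → a ≡ true) → a ≡ b
bool-ext {true}          f g = ≡.sym (f ≡.refl)
bool-ext {false} {true}  f g = g ≡.refl
bool-ext {false} {false} f g = ≡.refl

∧-true⁻ : ∀ a {b} → a ∧ b ≡ true → (a ≡ true) × (b ≡ true)
∧-true⁻ true e = ≡.refl , e

∧-true⁺ : ∀ {a b} → a ≡ true → b ≡ true → a ∧ b ≡ true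
∧-true⁺ ≡.refl e = e

∨-true⁻ : ∀ a {b} → a ∨ b ≡ true → (a ≡ true) ⊎ (b ≡ true)
∨-true⁻ true  _ = inj₁ ≡.refl
∨-true⁻ false e = inj₂ e

∨-true⁺ˡ : ∀ {a} b → a ≡ true → a ∨ b ≡ true
∨-true⁺ˡ b ≡.refl = ≡.refl

∨-true⁺ʳ : ∀ a {b} → b ≡ true → a ∨ b ≡ true
∨-true⁺ʳ true  _ = ≡.refl
∨-true⁺ʳ false e = e

module _ {A : Set} where

  sumOver : List A → (A → ℕ) → ℕ
  sumOver []       f = 0
  sumOver (x ∷ xs) f = f x +ℕ sumOver xs f

  sumOver-cong : ∀ l {f g : A → ℕ} → (∀ x → f x ≡ g x) → sumOver l f ≡ sumOver l g
  sumOver-cong []      e = ≡.refl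
  sumOver-cong (x ∷ l) e = cong₂ _+ℕ_ (e x) (sumOver-cong l e)

  sumOver-+ : ∀ l (f g : A → ℕ) → sumOver l (λ x → f x +ℕ g x) ≡ sumOver l f +ℕ sumOver l g
  sumOver-+ []      f g = ≡.refl
  sumOver-+ (x ∷ l) f g = ≡.trans (cong (f x +ℕ g x +ℕ_) (sumOver-+ l f g))
    (CS.interchange (f x) (g x) (sumOver l f) (sumOver l g))
    where import Algebra.Properties.CommutativeSemigroup ℕ.+-commutativeSemigroup as CS

  sumOver-const : ∀ l c → sumOver l (λ _ → c) ≡ length l *ℕ c
  sumOver-const []      c = ≡.refl
  sumOver-const (x ∷ l) c = cong (c +ℕ_) (sumOver-const l c)

  sumOver-*ˡ : ∀ l c (f : A → ℕ) → sumOver l (λ x → c *ℕ f x) ≡ c *ℕ sumOver l f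
  sumOver-*ˡ []      c f = ≡.sym (ℕ.*-zeroʳ c)
  sumOver-*ˡ (x ∷ l) c f = ≡.trans (cong (c *ℕ f x +ℕ_) (sumOver-*ˡ l c f)) (≡.sym (ℕ.*-distribˡ-+ c (f x) _))

  sumOver-*ʳ : ∀ l c (f : A → ℕ) → sumOver l (λ x → f x *ℕ c) ≡ sumOver l f *ℕ c
  sumOver-*ʳ l c f = ≡.trans (sumOver-cong l (λ x → ℕ.*-comm (f x) c))
                       (≡.trans (sumOver-*ˡ l c f) (ℕ.*-comm c _))

  sumOver-++ : ∀ l m (f : A → ℕ) → sumOver (l ++ m) f ≡ sumOver l f +ℕ sumOver m f
  sumOver-++ []      m f = ≡.refl
  sumOver-++ (x ∷ l) m f = ≡.trans (cong (f x +ℕ_) (sumOver-++ l m f)) (≡.sym (ℕ.+-assoc (f x) _ _))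

  count≡sumOver : ∀ l (p : A → Bool) → count l p ≡ sumOver l (λ x → ⟦ p x ⟧ᵇ)
  count≡sumOver []      p = ≡.refl
  count≡sumOver (x ∷ l) p with p x
  ... | true  = cong suc (count≡sumOver l p)
  ... | false = count≡sumOver l p

  anyL⁺ : ∀ l (p : A → Bool) → Any (λ x → p x ≡ true) l → anyL l p ≡ true
  anyL⁺ (x ∷ l) p (here e) rewrite e = ≡.refl
  anyL⁺ (x ∷ l) p (there a) with p x
  ... | true  = ≡.refl
  ... | false = anyL⁺ l p a

  anyL⁻ : ∀ l (p : A → Bool) → anyL l p ≡ true → ∃ λ x → p x ≡ true
  anyL⁻ (x ∷ l) p e with p x in eq
  ... | true  = x , eq
  ... | false = anyL⁻ l p e

  anyL-cong : ∀ l {p p′ : A → Bool} → (∀ x → p x ≡ p′ x) → anyL l p ≡ anyL l p′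
  anyL-cong []      e = ≡.refl
  anyL-cong (x ∷ l) e = cong₂ _∨_ (e x) (anyL-cong l e)

  allL⁺ : ∀ l (p : A → Bool) → (∀ x → p x ≡ true) → allL l p ≡ true
  allL⁺ []      p f = ≡.refl
  allL⁺ (x ∷ l) p f rewrite f x = allL⁺ l p f

  allL⁻ : ∀ l (p : A → Bool) → allL l p ≡ true → All (λ x → p x ≡ true) l
  allL⁻ []      p e = []
  allL⁻ (x ∷ l) p e with p x in eq
  ... | true = eq ∷ allL⁻ l p e

  pigeonhole : ∀ l (f g : A → Bool) →
               length l ℕ.< sumOver l (λ t → ⟦ f t ⟧ᵇ) +ℕ sumOver l (λ t → ⟦ g t ⟧ᵇ) →
               ∃ λ t → f t ∧ g t ≡ true
  pigeonhole l f g lt with anyL l (λ t → f t ∧ g t) in eq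
  ... | true  = anyL⁻ l (λ t → f t ∧ g t) eq
  ... | false = ⊥-elim (ℕ.<⇒≱ lt (ℕ.≤-trans (ℕ.≤-reflexive (≡.sym (sumOver-+ l _ _))) (disjoint l eq)))
    where
    disjoint : ∀ l → anyL l (λ t → f t ∧ g t) ≡ false →
               sumOver l (λ t → ⟦ f t ⟧ᵇ +ℕ ⟦ g t ⟧ᵇ) ℕ.≤ length l
    disjoint []      e = ℕ.z≤n
    disjoint (x ∷ l) e with f x | g x
    disjoint (x ∷ l) () | true  | true
    ... | true  | false = ℕ.s≤s (disjoint l e)
    ... | false | true  = ℕ.s≤s (disjoint l e)
    ... | false | false = ℕ.m≤n⇒m≤1+n (disjoint l e)

module _ {A B : Set} where

  sumOver-swap : ∀ (l : List A) (m : List B) (h : A → B → ℕ) →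
    sumOver l (λ x → sumOver m (h x)) ≡ sumOver m (λ y → sumOver l (λ x → h x y))
  sumOver-swap []      m h = ≡.sym (≡.trans (sumOver-const m 0) (ℕ.*-zeroʳ (length m)))
  sumOver-swap (x ∷ l) m h = ≡.trans (cong (sumOver m (h x) +ℕ_) (sumOver-swap l m h))
    (≡.sym (sumOver-+ m (h x) (λ y → sumOver l (λ x → h x y))))

  sumOver-concatMap : ∀ (l : List B) (g : B → List A) (f : A → ℕ) →
    sumOver (concatMap g l) f ≡ sumOver l (λ y → sumOver (g y) f)
  sumOver-concatMap []      g f = ≡.refl
  sumOver-concatMap (y ∷ l) g f = ≡.trans (sumOver-++ (g y) (concatMap g l) f)
    (cong (sumOver (g y) f +ℕ_) (sumOver-concatMap l g f))

  sumOver-map : ∀ (l : List B) (g : B → A) (f : A → ℕ) → sumOver (map g l) f ≡ sumOver l (f ∘ g)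
  sumOver-map []      g f = ≡.refl
  sumOver-map (y ∷ l) g f = cong (f (g y) +ℕ_) (sumOver-map l g f)

n²≡1+[n-1]s⇒s≡n+1 : ∀ {n z s} → 1 +ℕ z ≡ n → 2 ℕ.≤ n → n *ℕ n ≡ 1 +ℕ z *ℕ s → s ≡ n +ℕ 1
n²≡1+[n-1]s⇒s≡n+1 {z = zero}  ≡.refl (ℕ.s≤s ()) _
n²≡1+[n-1]s⇒s≡n+1 {z = suc z} ≡.refl _ eq =
  ≡.sym (ℕ.*-cancelˡ-≡ _ _ (suc z) (ℕ.+-cancelˡ-≡ 1 _ _ (≡.trans (≡.sym (expand z)) eq)))
  where
  expand : ∀ z → (2 +ℕ z) *ℕ (2 +ℕ z) ≡ 1 +ℕ (1 +ℕ z) *ℕ (2 +ℕ z +ℕ 1)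
  expand = solve-∀

module FiniteFieldProperties (F : FiniteField) where

  open FiniteField F
  open import Algebra.Properties.Ring (CommutativeRing.ring ring) public
  open IntegerCoefficientSolver ring

  module ≈-Reasoning = Relation.Binary.Reasoning.Setoid setoid
  open ≈-Reasoning

  two : Carrier
  two = 1# + 1#

  -- `recip` searches `elems` with a function local to its definition; the
  -- metavariable below is solved by that function, which makes it available
  -- for induction on the list.
  private
    mutual
      search : Carrier → List Carrier → Carrier
      search = _

      recip≡search : ∀ x → recip x ≡ search x elems
      recip≡search x with elems
      ... | _ = ≡.refl

    search-inverse : ∀ x l → Any (λ y → x * y ≈ 1#) l → x * search x l ≈ 1#
    search-inverse x (y ∷ l) p with (x * y) ≟ 1#
    ... | yes xy≈1 = xy≈1
    search-inverse x (y ∷ l) (here xy≈1) | no xy≉1 = ⊥-elim (xy≉1 xy≈1)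
    search-inverse x (y ∷ l) (there p)   | no _    = search-inverse x l p

  recip-inverseʳ : ∀ {x} → ¬ x ≈ 0# → x * recip x ≈ 1#
  recip-inverseʳ {x} x≉0 = ≡.subst (λ r → x * r ≈ 1#) (≡.sym (recip≡search x))
    (search-inverse x elems (Any.map (λ y≈z → trans (*-congˡ (sym y≈z)) (proj₂ (inverse x x≉0)))
                                     (complete (proj₁ (inverse x x≉0)))))

  recip-inverseˡ : ∀ {x} → ¬ x ≈ 0# → recip x * x ≈ 1#
  recip-inverseˡ x≉0 = trans (*-comm _ _) (recip-inverseʳ x≉0)

  *-cancelˡ-≈0 : ∀ {x y} → ¬ x ≈ 0# → x * y ≈ 0# → y ≈ 0#
  *-cancelˡ-≈0 {x} {y} x≉0 xy≈0 = begin
    y                   ≈⟨ *-identityˡ y ⟨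
    1# * y              ≈⟨ *-congʳ (recip-inverseˡ x≉0) ⟨
    (recip x * x) * y   ≈⟨ *-assoc _ _ _ ⟩
    recip x * (x * y)   ≈⟨ *-congˡ xy≈0 ⟩
    recip x * 0#        ≈⟨ zeroʳ _ ⟩
    0#                  ∎

  *-≉0 : ∀ {x y} → ¬ x ≈ 0# → ¬ y ≈ 0# → ¬ x * y ≈ 0#
  *-≉0 x≉0 y≉0 xy≈0 = y≉0 (*-cancelˡ-≈0 x≉0 xy≈0)

  *-cancelˡ : ∀ {u x y} → ¬ u ≈ 0# → u * x ≈ u * y → x ≈ y
  *-cancelˡ {u} {x} {y} u≉0 ux≈uy = x∙y⁻¹≈ε⇒x≈y x y (*-cancelˡ-≈0 u≉0 (begin
    u * (x - y)     ≈⟨ x[y-z]≈xy-xz u x y ⟩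
    u * x - u * y   ≈⟨ x≈y⇒x∙y⁻¹≈ε ux≈uy ⟩
    0#              ∎))

  recip-≉0 : ∀ {x} → ¬ x ≈ 0# → ¬ recip x ≈ 0#
  recip-≉0 {x} x≉0 r≈0 = 1≉0 (trans (sym (recip-inverseʳ x≉0)) (trans (*-congˡ r≈0) (zeroʳ x)))

  square-≈0 : ∀ {a} → a * a ≈ 0# → a ≈ 0#
  square-≈0 {a} aa≈0 with a ≟ 0#
  ... | yes a≈0 = a≈0
  ... | no a≉0  = *-cancelˡ-≈0 a≉0 aa≈0

  square-roots : ∀ {a b} → a * a ≈ b * b → a ≈ b ⊎ a ≈ - b
  square-roots {a} {b} aa≈bb with (a - b) ≟ 0#
  ... | yes a-b≈0 = inj₁ (x∙y⁻¹≈ε⇒x≈y a b a-b≈0)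
  ... | no a-b≉0  = inj₂ (x∙y⁻¹≈ε⇒x≈y a (- b)
    (trans (+-congˡ (-‿involutive b)) (*-cancelˡ-≈0 a-b≉0 (begin
      (a - b) * (a + b)   ≈⟨ solve 2 (λ a b → (a :- b) :* (a :+ b) := a :* a :- b :* b) refl a b ⟩
      a * a - b * b       ≈⟨ x≈y⇒x∙y⁻¹≈ε aa≈bb ⟩
      0#                  ∎))))

  ≈⇒== : ∀ {a b} → a ≈ b → (a == b) ≡ true
  ≈⇒== {a} {b} p with a ≟ b
  ... | yes _ = ≡.refl
  ... | no ¬p = ⊥-elim (¬p p)

  ≉⇒== : ∀ {a b} → ¬ a ≈ b → (a == b) ≡ false
  ≉⇒== {a} {b} ¬p with a ≟ b
  ... | yes p = ⊥-elim (¬p p)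
  ... | no _  = ≡.refl

  ==⇒≈ : ∀ {a b} → (a == b) ≡ true → a ≈ b
  ==⇒≈ {a} {b} e with a ≟ b
  ... | yes p = p

  ==-cong-⇔ : ∀ {a b c d} → (a ≈ b → c ≈ d) → (c ≈ d → a ≈ b) → (a == b) ≡ (c == d)
  ==-cong-⇔ f g = bool-ext (≈⇒== ∘ f ∘ ==⇒≈) (≈⇒== ∘ g ∘ ==⇒≈)

  ==-cong : ∀ {a b c d} → a ≈ c → b ≈ d → (a == b) ≡ (c == d)
  ==-cong p q = ==-cong-⇔ (λ r → trans (sym p) (trans r q)) (λ r → trans p (trans r (sym q)))

  ==-sym : ∀ a b → (a == b) ≡ (b == a)
  ==-sym a b = ==-cong-⇔ sym sym

module FiniteFieldSums (F : FiniteField) where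

  open FiniteField F
  open FiniteFieldProperties F
  open IntegerCoefficientSolver ring

  q : ℕ
  q = order

  q≥2 : 2 ℕ.≤ q
  q≥2 = two-elements elems (complete 0#) (complete 1#)
    where
    two-elements : ∀ l → Any (0# ≈_) l → Any (1# ≈_) l → 2 ℕ.≤ length l
    two-elements (y ∷ [])    (here 0≈y) (here 1≈y) = ⊥-elim (1≉0 (trans 1≈y (sym 0≈y)))
    two-elements (y ∷ z ∷ l) _          _          = ℕ.s≤s (ℕ.s≤s ℕ.z≤n)

  ∑ : (Carrier → ℕ) → ℕ
  ∑ = sumOver elems

  ∑-cong : {f g : Carrier → ℕ} → (∀ x → f x ≡ g x) → ∑ f ≡ ∑ g
  ∑-cong = sumOver-cong elems

  ∑-const : ∀ c → ∑ (λ _ → c) ≡ q *ℕ c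
  ∑-const = sumOver-const elems

  ∑-1 : ∑ (λ _ → 1) ≡ q
  ∑-1 = ≡.trans (∑-const 1) (ℕ.*-identityʳ q)

  ∑-swap : (h : Carrier → Carrier → ℕ) → ∑ (λ x → ∑ (h x)) ≡ ∑ (λ y → ∑ (λ x → h x y))
  ∑-swap = sumOver-swap elems elems

  ∑-δ : ∀ c → ∑ (λ x → ⟦ x == c ⟧ᵇ) ≡ 1
  ∑-δ c = go elems distinct (complete c)
    where
    none : ∀ l → All (λ x → ¬ x ≈ c) l → sumOver l (λ x → ⟦ x == c ⟧ᵇ) ≡ 0
    none []      []         = ≡.refl
    none (y ∷ l) (y≉c ∷ ps) rewrite ≉⇒== y≉c = none l ps
    go : ∀ l → AllPairs (λ a b → ¬ a ≈ b) l → Any (c ≈_) l →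
         sumOver l (λ x → ⟦ x == c ⟧ᵇ) ≡ 1
    go (y ∷ l) (y≉l ∷ _) (here c≈y) rewrite ≈⇒== (sym c≈y) =
      cong suc (none l (All.map (λ y≉z z≈c → y≉z (trans (sym c≈y) (sym z≈c))) y≉l))
    go (y ∷ l) (y≉l ∷ d) (there c∈l) rewrite ≉⇒== (λ y≈c → All.lookupWith (λ y≉z c≈z → y≉z (trans y≈c c≈z)) y≉l c∈l) =
      go l d c∈l

  1+#nonzero≡q : 1 +ℕ ∑ (λ x → ⟦ not (x == 0#) ⟧ᵇ) ≡ q
  1+#nonzero≡q = begin
    1 +ℕ ∑ (λ x → ⟦ not (x == 0#) ⟧ᵇ)                   ≡⟨ cong (_+ℕ ∑ (λ x → ⟦ not (x == 0#) ⟧ᵇ)) (∑-δ 0#) ⟨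
    ∑ (λ x → ⟦ x == 0# ⟧ᵇ) +ℕ ∑ (λ x → ⟦ not (x == 0#) ⟧ᵇ) ≡⟨ sumOver-+ elems _ _ ⟨
    ∑ (λ x → ⟦ x == 0# ⟧ᵇ +ℕ ⟦ not (x == 0#) ⟧ᵇ)         ≡⟨ ∑-cong (λ x → b+not-b (x == 0#)) ⟩
    ∑ (λ _ → 1)                                        ≡⟨ ∑-1 ⟩
    q                                                  ∎
    where
    open ≡.≡-Reasoning
    b+not-b : ∀ b → ⟦ b ⟧ᵇ +ℕ ⟦ not b ⟧ᵇ ≡ 1
    b+not-b true  = ≡.refl
    b+not-b false = ≡.refl

  ∑-δ-* : ∀ c (f : Carrier → ℕ) → f Preserves _≈_ ⟶ _≡_ → ∑ (λ x → ⟦ x == c ⟧ᵇ *ℕ f x) ≡ f c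
  ∑-δ-* c f f-resp = begin
    ∑ (λ x → ⟦ x == c ⟧ᵇ *ℕ f x)   ≡⟨ ∑-cong at-c ⟩
    ∑ (λ x → ⟦ x == c ⟧ᵇ *ℕ f c)   ≡⟨ sumOver-*ʳ elems (f c) _ ⟩
    ∑ (λ x → ⟦ x == c ⟧ᵇ) *ℕ f c   ≡⟨ cong (_*ℕ f c) (∑-δ c) ⟩
    1 *ℕ f c                       ≡⟨ ℕ.*-identityˡ (f c) ⟩
    f c                            ∎
    where
    open ≡.≡-Reasoning
    at-c : ∀ x → ⟦ x == c ⟧ᵇ *ℕ f x ≡ ⟦ x == c ⟧ᵇ *ℕ f c
    at-c x with x ≟ c
    ... | yes x≈c = cong (1 *ℕ_) (f-resp x≈c)
    ... | no _    = ≡.refl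

  ∑-δ-∧ : ∀ c (b : Carrier → Bool) → b Preserves _≈_ ⟶ _≡_ → ∑ (λ x → ⟦ (x == c) ∧ b x ⟧ᵇ) ≡ ⟦ b c ⟧ᵇ
  ∑-δ-∧ c b b-resp = ≡.trans (∑-cong (λ x → ⟦∧⟧ᵇ (x == c) (b x))) (∑-δ-* c (⟦_⟧ᵇ ∘ b) (cong ⟦_⟧ᵇ ∘ b-resp))

  ∑-unique : ∀ c (P : Carrier → Bool) → P Preserves _≈_ ⟶ _≡_ → (∀ x → P x ≡ true → x ≈ c) →
             ∑ (λ x → ⟦ P x ⟧ᵇ) ≡ ⟦ P c ⟧ᵇ
  ∑-unique c P P-resp only-c = ≡.trans (∑-cong (λ x → cong ⟦_⟧ᵇ (bool-ext
      (λ Px → ∧-true⁺ (≈⇒== (only-c x Px)) Px) (proj₂ ∘ ∧-true⁻ (x == c)))))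
    (∑-δ-∧ c P P-resp)

  ∑-reindex : (σ τ : Carrier → Carrier) → σ Preserves _≈_ ⟶ _≈_ → τ Preserves _≈_ ⟶ _≈_ →
              (∀ y → σ (τ y) ≈ y) → (∀ x → τ (σ x) ≈ x) →
              (f : Carrier → ℕ) → f Preserves _≈_ ⟶ _≡_ → ∑ (f ∘ σ) ≡ ∑ f
  ∑-reindex σ τ σ-cong τ-cong στ τσ f f-resp = begin
    ∑ (λ x → f (σ x))                          ≡⟨ ∑-cong (λ x → ∑-δ-* (σ x) f f-resp) ⟨
    ∑ (λ x → ∑ (λ y → ⟦ y == σ x ⟧ᵇ *ℕ f y))   ≡⟨ ∑-swap (λ x y → ⟦ y == σ x ⟧ᵇ *ℕ f y) ⟩
    ∑ (λ y → ∑ (λ x → ⟦ y == σ x ⟧ᵇ *ℕ f y))   ≡⟨ ∑-cong (λ y → ∑-cong (λ x → cong (λ b → ⟦ b ⟧ᵇ *ℕ f y) (transpose x y))) ⟩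
    ∑ (λ y → ∑ (λ x → ⟦ x == τ y ⟧ᵇ *ℕ f y))   ≡⟨ ∑-cong (λ y → ∑-δ-* (τ y) (λ _ → f y) (λ _ → ≡.refl)) ⟩
    ∑ f                                        ∎
    where
    open ≡.≡-Reasoning
    transpose : ∀ x y → (y == σ x) ≡ (x == τ y)
    transpose x y = ==-cong-⇔ (λ y≈σx → trans (sym (τσ x)) (τ-cong (sym y≈σx)))
                              (λ x≈τy → trans (sym (στ y)) (σ-cong (sym x≈τy)))

  ∑-affine : ∀ {α} c → ¬ α ≈ 0# → (f : Carrier → ℕ) → f Preserves _≈_ ⟶ _≡_ → ∑ (λ a → f (α * a + c)) ≡ ∑ f
  ∑-affine {α} c α≉0 = ∑-reindex (λ a → α * a + c) (λ u → recip α * (u - c))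
    (λ p → +-congʳ (*-congˡ p)) (λ p → *-congˡ (+-congʳ p))
    (λ u → begin
      α * (recip α * (u - c)) + c   ≈⟨ solve 4 (λ α r u c → α :* (r :* (u :- c)) :+ c := (α :* r) :* (u :- c) :+ c) refl α (recip α) u c ⟩
      (α * recip α) * (u - c) + c   ≈⟨ +-congʳ (*-congʳ (recip-inverseʳ α≉0)) ⟩
      1# * (u - c) + c              ≈⟨ solve 2 (λ u c → con (+ 1) :* (u :- c) :+ c := u) refl u c ⟩
      u                             ∎)
    (λ a → begin
      recip α * (α * a + c - c)     ≈⟨ solve 4 (λ α r a c → r :* (α :* a :+ c :- c) := (r :* α) :* a) refl α (recip α) a c ⟩
      (recip α * α) * a             ≈⟨ *-congʳ (recip-inverseˡ α≉0) ⟩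
      1# * a                        ≈⟨ *-identityˡ a ⟩
      a                             ∎)
    where open ≈-Reasoning

  ∑₂ : (Carrier → Carrier → ℕ) → ℕ
  ∑₂ f = ∑ (λ a → ∑ (f a))

  ∑₂-cong : {f g : Carrier → Carrier → ℕ} → (∀ a b → f a b ≡ g a b) → ∑₂ f ≡ ∑₂ g
  ∑₂-cong e = ∑-cong (λ a → ∑-cong (e a))

  ∑₂-const : ∀ c → ∑₂ (λ _ _ → c) ≡ q *ℕ (q *ℕ c)
  ∑₂-const c = ≡.trans (∑-cong (λ _ → ∑-const c)) (∑-const _)

  ∑₂-swap : (h : Carrier → Carrier → Carrier → Carrier → ℕ) →
            ∑₂ (λ a b → ∑₂ (h a b)) ≡ ∑₂ (λ u v → ∑₂ (λ a b → h a b u v))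
  ∑₂-swap h = begin
    ∑ (λ a → ∑ (λ b → ∑ (λ u → ∑ (h a b u))))           ≡⟨ ∑-cong (λ a → ∑-swap (λ b u → ∑ (h a b u))) ⟩
    ∑ (λ a → ∑ (λ u → ∑ (λ b → ∑ (h a b u))))           ≡⟨ ∑-swap (λ a u → ∑ (λ b → ∑ (h a b u))) ⟩
    ∑ (λ u → ∑ (λ a → ∑ (λ b → ∑ (h a b u))))           ≡⟨ ∑-cong (λ u → ∑-cong (λ a → ∑-swap (λ b → h a b u))) ⟩
    ∑ (λ u → ∑ (λ a → ∑ (λ v → ∑ (λ b → h a b u v))))   ≡⟨ ∑-cong (λ u → ∑-swap (λ a v → ∑ (λ b → h a b u v))) ⟩
    ∑ (λ u → ∑ (λ v → ∑ (λ a → ∑ (λ b → h a b u v))))   ∎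
    where open ≡.≡-Reasoning

  open Setoid (setoid ×ₛ setoid) public
    using () renaming (_≈_ to _≈₂_; sym to ≈₂-sym; trans to ≈₂-trans)

  infix 4 _==₂_

  _==₂_ : Carrier × Carrier → Carrier × Carrier → Bool
  x ==₂ y = (proj₁ x == proj₁ y) ∧ (proj₂ x == proj₂ y)

  ==₂⇒≈₂ : ∀ {x y} → (x ==₂ y) ≡ true → x ≈₂ y
  ==₂⇒≈₂ {x} e with ∧-true⁻ (proj₁ x == _) e
  ... | e₁ , e₂ = ==⇒≈ e₁ , ==⇒≈ e₂

  ≈₂⇒==₂ : ∀ {x y} → x ≈₂ y → (x ==₂ y) ≡ true
  ≈₂⇒==₂ (p₁ , p₂) = ∧-true⁺ (≈⇒== p₁) (≈⇒== p₂)

  ∑₂-δ : ∀ c (f : Carrier × Carrier → ℕ) → f Preserves _≈₂_ ⟶ _≡_ →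
         ∑₂ (λ a b → ⟦ (a , b) ==₂ c ⟧ᵇ *ℕ f (a , b)) ≡ f c
  ∑₂-δ (c₁ , c₂) f f-resp = begin
    ∑₂ (λ a b → ⟦ (a == c₁) ∧ (b == c₂) ⟧ᵇ *ℕ f (a , b))
      ≡⟨ ∑₂-cong (λ a b → ≡.trans (cong (_*ℕ f (a , b)) (⟦∧⟧ᵇ (a == c₁) (b == c₂))) (ℕ.*-assoc ⟦ a == c₁ ⟧ᵇ _ _)) ⟩
    ∑ (λ a → ∑ (λ b → ⟦ a == c₁ ⟧ᵇ *ℕ (⟦ b == c₂ ⟧ᵇ *ℕ f (a , b))))
      ≡⟨ ∑-cong (λ a → sumOver-*ˡ elems ⟦ a == c₁ ⟧ᵇ _) ⟩
    ∑ (λ a → ⟦ a == c₁ ⟧ᵇ *ℕ ∑ (λ b → ⟦ b == c₂ ⟧ᵇ *ℕ f (a , b)))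
      ≡⟨ ∑-cong (λ a → cong (⟦ a == c₁ ⟧ᵇ *ℕ_) (∑-δ-* c₂ (λ b → f (a , b)) (λ p → f-resp (refl , p)))) ⟩
    ∑ (λ a → ⟦ a == c₁ ⟧ᵇ *ℕ f (a , c₂))
      ≡⟨ ∑-δ-* c₁ (λ a → f (a , c₂)) (λ p → f-resp (p , refl)) ⟩
    f (c₁ , c₂) ∎
    where open ≡.≡-Reasoning

  ∑₂-reindex : (σ τ : Carrier × Carrier → Carrier × Carrier) →
               σ Preserves _≈₂_ ⟶ _≈₂_ → τ Preserves _≈₂_ ⟶ _≈₂_ →
               (∀ y → σ (τ y) ≈₂ y) → (∀ x → τ (σ x) ≈₂ x) →
               (f : Carrier × Carrier → ℕ) → f Preserves _≈₂_ ⟶ _≡_ →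
               ∑₂ (λ a b → f (σ (a , b))) ≡ ∑₂ (λ a b → f (a , b))
  ∑₂-reindex σ τ σ-cong τ-cong στ τσ f f-resp = begin
    ∑₂ (λ a b → f (σ (a , b)))
      ≡⟨ ∑₂-cong (λ a b → ∑₂-δ (σ (a , b)) f f-resp) ⟨
    ∑₂ (λ a b → ∑₂ (λ u v → ⟦ (u , v) ==₂ σ (a , b) ⟧ᵇ *ℕ f (u , v)))
      ≡⟨ ∑₂-swap (λ a b u v → ⟦ (u , v) ==₂ σ (a , b) ⟧ᵇ *ℕ f (u , v)) ⟩
    ∑₂ (λ u v → ∑₂ (λ a b → ⟦ (u , v) ==₂ σ (a , b) ⟧ᵇ *ℕ f (u , v)))
      ≡⟨ ∑₂-cong (λ u v → ∑₂-cong (λ a b → cong (λ t → ⟦ t ⟧ᵇ *ℕ f (u , v)) (transpose (a , b) (u , v)))) ⟩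
    ∑₂ (λ u v → ∑₂ (λ a b → ⟦ (a , b) ==₂ τ (u , v) ⟧ᵇ *ℕ f (u , v)))
      ≡⟨ ∑₂-cong (λ u v → ∑₂-δ (τ (u , v)) (λ _ → f (u , v)) (λ _ → ≡.refl)) ⟩
    ∑₂ (λ u v → f (u , v)) ∎
    where
    open ≡.≡-Reasoning
    transpose : ∀ x y → (y ==₂ σ x) ≡ (x ==₂ τ y)
    transpose x y = bool-ext
      (λ e → ≈₂⇒==₂ (≈₂-trans (≈₂-sym (τσ x)) (τ-cong (≈₂-sym (==₂⇒≈₂ e)))))
      (λ e → ≈₂⇒==₂ (≈₂-trans (≈₂-sym (στ y)) (σ-cong (≈₂-sym (==₂⇒≈₂ e)))))

  ∑-linear : ∀ {L} R c → ¬ L ≈ 0# → ∑ (λ a → ⟦ (L * a + R) == c ⟧ᵇ) ≡ 1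
  ∑-linear R c L≉0 = ≡.trans (∑-affine R L≉0 (λ u → ⟦ u == c ⟧ᵇ) (λ p → cong ⟦_⟧ᵇ (==-cong p refl))) (∑-δ c)

  ∑₂-affine : ∀ {L₁ L₂} C c → ¬ (L₁ ≈ 0# × L₂ ≈ 0#) → ∑₂ (λ a b → ⟦ (L₁ * a + L₂ * b + C) == c ⟧ᵇ) ≡ q
  ∑₂-affine {L₁} {L₂} C c L≉0 with L₁ ≟ 0# | L₂ ≟ 0#
  ... | yes L₁≈0 | yes L₂≈0 = ⊥-elim (L≉0 (L₁≈0 , L₂≈0))
  ... | no L₁≉0 | _ = ≡.trans (∑-swap _) (≡.trans (∑-cong λ b →
      ≡.trans (∑-cong (λ a → cong ⟦_⟧ᵇ (==-cong (+-assoc _ _ _) refl))) (∑-linear (L₂ * b + C) c L₁≉0)) ∑-1)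
  ... | yes _ | no L₂≉0 = ≡.trans (∑-cong λ a →
      ≡.trans (∑-cong (λ b → cong ⟦_⟧ᵇ (==-cong (reorder a b) refl))) (∑-linear (L₁ * a + C) c L₂≉0)) ∑-1
    where
    reorder : ∀ a b → L₁ * a + L₂ * b + C ≈ L₂ * b + (L₁ * a + C)
    reorder a b = solve 5 (λ L₁ L₂ C a b → L₁ :* a :+ L₂ :* b :+ C := L₂ :* b :+ (L₁ :* a :+ C)) refl L₁ L₂ C a b

  ∑₂-constant : ∀ {L₁ L₂} C c → L₁ ≈ 0# → L₂ ≈ 0# → ∑₂ (λ a b → ⟦ (L₁ * a + L₂ * b + C) == c ⟧ᵇ) ≡ q *ℕ (q *ℕ ⟦ C == c ⟧ᵇ)
  ∑₂-constant {L₁} {L₂} C c L₁≈0 L₂≈0 = ≡.trans (∑₂-cong (λ a b → cong ⟦_⟧ᵇ (==-cong (vanish a b) refl))) (∑₂-const _)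
    where
    vanish : ∀ a b → L₁ * a + L₂ * b + C ≈ C
    vanish a b = trans (+-congʳ (+-cong (*-congʳ L₁≈0) (*-congʳ L₂≈0)))
                       (solve 3 (λ a b C → con (+ 0) :* a :+ con (+ 0) :* b :+ C := C) refl a b C)

module HeisenbergCounting (F : FiniteField) where

  open FiniteField F
  open Heisenberg F
  open FiniteFieldProperties F
  open FiniteFieldSums F
  open IntegerCoefficientSolver ring

  open Setoid (setoid ×ₛ (setoid ×ₛ setoid)) public
    using () renaming (_≈_ to _≈G_; refl to ≈G-refl; sym to ≈G-sym; trans to ≈G-trans)

  ≈G⇒=G : ∀ {g h} → g ≈G h → (g =G h) ≡ true
  ≈G⇒=G (p₁ , p₂ , p₃) = ∧-true⁺ (≈⇒== p₁) (∧-true⁺ (≈⇒== p₂) (≈⇒== p₃))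

  =G⇒≈G : ∀ {g h} → (g =G h) ≡ true → g ≈G h
  =G⇒≈G {g} e with ∧-true⁻ (proj₁ g == _) e
  ... | e₁ , e₂₃ with ∧-true⁻ (proj₁ (proj₂ g) == _) e₂₃
  ... | e₂ , e₃ = ==⇒≈ e₁ , ==⇒≈ e₂ , ==⇒≈ e₃

  ·-cong : _·_ Preserves₂ _≈G_ ⟶ _≈G_ ⟶ _≈G_
  ·-cong (p₁ , p₂ , p₃) (q₁ , q₂ , q₃) = +-cong p₁ q₁ , +-cong p₂ q₂ , +-cong (+-cong p₃ q₃) (*-cong p₁ q₂)

  inv-cong : inv Preserves _≈G_ ⟶ _≈G_
  inv-cong (p₁ , p₂ , p₃) = -‿cong p₁ , -‿cong p₂ , +-cong (-‿cong p₃) (*-cong p₁ p₂)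

  inv-·-cancel : ∀ a b → inv a · (a · b) ≈G b
  inv-·-cancel (a₁ , a₂ , a₃) (b₁ , b₂ , b₃) =
      solve 2 (λ a b → :- a :+ (a :+ b) := b) refl a₁ b₁
    , solve 2 (λ a b → :- a :+ (a :+ b) := b) refl a₂ b₂
    , solve 5 (λ a₁ a₂ a₃ b₂ b₃ → (:- a₃ :+ a₁ :* a₂) :+ (a₃ :+ b₃ :+ a₁ :* b₂) :+ (:- a₁) :* (a₂ :+ b₂) := b₃)
        refl a₁ a₂ a₃ b₂ b₃

  ·-inv-cancel : ∀ a g → a · (inv a · g) ≈G g
  ·-inv-cancel (a₁ , a₂ , a₃) (g₁ , g₂ , g₃) =
      solve 2 (λ a g → a :+ (:- a :+ g) := g) refl a₁ g₁
    , solve 2 (λ a g → a :+ (:- a :+ g) := g) refl a₂ g₂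
    , solve 5 (λ a₁ a₂ a₃ g₂ g₃ → a₃ :+ ((:- a₃ :+ a₁ :* a₂) :+ g₃ :+ (:- a₁) :* g₂) :+ a₁ :* (:- a₂ :+ g₂) := g₃)
        refl a₁ a₂ a₃ g₂ g₃

  ·≈⇒≈inv· : ∀ {a b g} → a · b ≈G g → b ≈G inv a · g
  ·≈⇒≈inv· {a} {b} ab≈g = ≈G-trans (≈G-sym (inv-·-cancel a b)) (·-cong ≈G-refl ab≈g)

  ∑G : (G → ℕ) → ℕ
  ∑G f = ∑ (λ x → ∑ (λ y → ∑ (λ z → f (x , y , z))))

  ∑G-cong : {f f′ : G → ℕ} → (∀ g → f g ≡ f′ g) → ∑G f ≡ ∑G f′
  ∑G-cong e = ∑-cong (λ x → ∑-cong (λ y → ∑-cong (λ z → e (x , y , z))))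

  sumOver-elemsG : (f : G → ℕ) → sumOver elemsG f ≡ ∑G f
  sumOver-elemsG f = ≡.trans (sumOver-concatMap elems _ f)
    (∑-cong (λ x → ≡.trans (sumOver-concatMap elems _ f) (∑-cong (λ y → sumOver-map elems _ f))))

  count-elemsG : (P : Subset) → count elemsG P ≡ ∑G (⟦_⟧ᵇ ∘ P)
  count-elemsG P = ≡.trans (count≡sumOver elemsG P) (sumOver-elemsG (⟦_⟧ᵇ ∘ P))

  ∑G-unique : ∀ c (P : Subset) → P Preserves _≈G_ ⟶ _≡_ → (∀ g → P g ≡ true → g ≈G c) →
              ∑G (⟦_⟧ᵇ ∘ P) ≡ ⟦ P c ⟧ᵇ
  ∑G-unique (c₁ , c₂ , c₃) P P-resp only-c = begin
    ∑ (λ x → ∑ (λ y → ∑ (λ z → ⟦ P (x , y , z) ⟧ᵇ)))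
      ≡⟨ ∑-cong (λ x → ∑-cong (λ y → ∑-unique c₃ (λ z → P (x , y , z))
           (λ p → P-resp (refl , refl , p)) (λ z → proj₂ ∘ proj₂ ∘ only-c _))) ⟩
    ∑ (λ x → ∑ (λ y → ⟦ P (x , y , c₃) ⟧ᵇ))
      ≡⟨ ∑-cong (λ x → ∑-unique c₂ (λ y → P (x , y , c₃))
           (λ p → P-resp (refl , p , refl)) (λ y → proj₁ ∘ proj₂ ∘ only-c _)) ⟩
    ∑ (λ x → ⟦ P (x , c₂ , c₃) ⟧ᵇ)
      ≡⟨ ∑-unique c₁ (λ x → P (x , c₂ , c₃)) (λ p → P-resp (p , refl , refl)) (λ x → proj₁ ∘ only-c _) ⟩
    ⟦ P (c₁ , c₂ , c₃) ⟧ᵇ ∎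
    where open ≡.≡-Reasoning

  -- `prodCoeff` sums with a function local to its definition; as for `recip`,
  -- the metavariable below is solved by it.
  private
    mutual
      prodSum : Subset → Subset → G → List G → ℕ
      prodSum = _

      prodCoeff≡prodSum : ∀ X Y g → prodCoeff X Y g ≡ prodSum X Y g elemsG
      prodCoeff≡prodSum X Y g with elemsG
      ... | _ = ≡.refl

    prodSum≡sumOver : ∀ X Y g l →
      prodSum X Y g l ≡ sumOver l (λ a → count elemsG (λ b → X a ∧ Y b ∧ ((a · b) =G g)))
    prodSum≡sumOver X Y g []      = ≡.refl
    prodSum≡sumOver X Y g (a ∷ l) = cong (_ +ℕ_) (prodSum≡sumOver X Y g l)

  prodCoeff≡∑G : ∀ X Y g → prodCoeff X Y g ≡ ∑G (λ a → ∑G (λ b → ⟦ X a ∧ Y b ∧ ((a · b) =G g) ⟧ᵇ))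
  prodCoeff≡∑G X Y g = begin
    prodCoeff X Y g                  ≡⟨ prodCoeff≡prodSum X Y g ⟩
    prodSum X Y g elemsG             ≡⟨ prodSum≡sumOver X Y g elemsG ⟩
    sumOver elemsG _                 ≡⟨ sumOver-elemsG _ ⟩
    ∑G (λ a → count elemsG _)        ≡⟨ ∑G-cong (λ a → count-elemsG _) ⟩
    ∑G (λ a → ∑G (λ b → ⟦ X a ∧ Y b ∧ ((a · b) =G g) ⟧ᵇ)) ∎
    where open ≡.≡-Reasoning

  prodCoeff-translate : ∀ X Y g → Y Preserves _≈G_ ⟶ _≡_ →
                        prodCoeff X Y g ≡ ∑G (λ a → ⟦ X a ∧ Y (inv a · g) ⟧ᵇ)
  prodCoeff-translate X Y g Y-resp = begin
    prodCoeff X Y g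
      ≡⟨ prodCoeff≡∑G X Y g ⟩
    ∑G (λ a → ∑G (λ b → ⟦ X a ∧ Y b ∧ ((a · b) =G g) ⟧ᵇ))
      ≡⟨ ∑G-cong (λ a → ∑G-unique (inv a · g) (λ b → X a ∧ Y b ∧ ((a · b) =G g)) (resp a) (only a)) ⟩
    ∑G (λ a → ⟦ X a ∧ Y (inv a · g) ∧ ((a · (inv a · g)) =G g) ⟧ᵇ)
      ≡⟨ ∑G-cong (λ a → cong (λ t → ⟦ X a ∧ Y (inv a · g) ∧ t ⟧ᵇ) (≈G⇒=G (·-inv-cancel a g))) ⟩
    ∑G (λ a → ⟦ X a ∧ Y (inv a · g) ∧ true ⟧ᵇ)
      ≡⟨ ∑G-cong (λ a → cong (λ t → ⟦ X a ∧ t ⟧ᵇ) (∧-identityʳ _)) ⟩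
    ∑G (λ a → ⟦ X a ∧ Y (inv a · g) ⟧ᵇ) ∎
    where
    open ≡.≡-Reasoning
    =G-resp : ∀ {h h′} → h ≈G h′ → (h =G g) ≡ (h′ =G g)
    =G-resp h≈h′ = bool-ext (λ e → ≈G⇒=G (≈G-trans (≈G-sym h≈h′) (=G⇒≈G e)))
                            (λ e → ≈G⇒=G (≈G-trans h≈h′ (=G⇒≈G e)))
    resp : ∀ a → (λ b → X a ∧ Y b ∧ ((a · b) =G g)) Preserves _≈G_ ⟶ _≡_
    resp a p = cong₂ (λ u v → X a ∧ u ∧ v) (Y-resp p) (=G-resp (·-cong ≈G-refl p))
    only : ∀ a b → (X a ∧ Y b ∧ ((a · b) =G g)) ≡ true → b ≈G inv a · g
    only a b e = ·≈⇒≈inv· (=G⇒≈G (proj₂ (∧-true⁻ (Y b) (proj₂ (∧-true⁻ (X a) e)))))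

  IsGraphOf : Subset → (Carrier → Carrier → Carrier) → Set
  IsGraphOf X f = ∀ x y z → X (x , y , z) ≡ (z == f x y)

  graph-resp : ∀ {X f} → f Preserves₂ _≈_ ⟶ _≈_ ⟶ _≈_ → IsGraphOf X f → X Preserves _≈G_ ⟶ _≡_
  graph-resp {X} f-cong X-graph {x , y , z} {x′ , y′ , z′} (p , q , r) =
    ≡.trans (X-graph x y z) (≡.trans (==-cong r (f-cong p q)) (≡.sym (X-graph x′ y′ z′)))

  ∑G-graph : ∀ {X f} → IsGraphOf X f → (Q : Subset) → Q Preserves _≈G_ ⟶ _≡_ →
             ∑G (λ a → ⟦ X a ∧ Q a ⟧ᵇ) ≡ ∑₂ (λ a₁ a₂ → ⟦ Q (a₁ , a₂ , f a₁ a₂) ⟧ᵇ)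
  ∑G-graph {X} {f} X-graph Q Q-resp = ∑-cong λ x → ∑-cong λ y →
    ≡.trans (∑-cong (λ z → cong (λ b → ⟦ b ∧ Q (x , y , z) ⟧ᵇ) (X-graph x y z)))
            (∑-δ-∧ (f x y) (λ z → Q (x , y , z)) (λ p → Q-resp (refl , refl , p)))

  prodCoeff-graphs : ∀ {X Y fX fY} → IsGraphOf X fX → IsGraphOf Y fY → fY Preserves₂ _≈_ ⟶ _≈_ ⟶ _≈_ →
    ∀ g₁ g₂ g₃ → prodCoeff X Y (g₁ , g₂ , g₃) ≡
      ∑₂ (λ a₁ a₂ → ⟦ (fX a₁ a₂ + fY (g₁ - a₁) (g₂ - a₂) + a₁ * (g₂ - a₂)) == g₃ ⟧ᵇ)
  prodCoeff-graphs {X} {Y} {fX} {fY} X-graph Y-graph fY-cong g₁ g₂ g₃ = begin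
    prodCoeff X Y g
      ≡⟨ prodCoeff-translate X Y g Y-resp ⟩
    ∑G (λ a → ⟦ X a ∧ Y (inv a · g) ⟧ᵇ)
      ≡⟨ ∑G-graph X-graph (λ a → Y (inv a · g)) (λ p → Y-resp (·-cong (inv-cong p) ≈G-refl)) ⟩
    ∑₂ (λ a₁ a₂ → ⟦ Y (inv (a₁ , a₂ , fX a₁ a₂) · g) ⟧ᵇ)
      ≡⟨ ∑₂-cong (λ a₁ a₂ → cong ⟦_⟧ᵇ (≡.trans (Y-graph _ _ _) (==-cong-⇔ (to a₁ a₂) (from a₁ a₂)))) ⟩
    ∑₂ (λ a₁ a₂ → ⟦ (fX a₁ a₂ + fY (g₁ - a₁) (g₂ - a₂) + a₁ * (g₂ - a₂)) == g₃ ⟧ᵇ) ∎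
    where
    open ≡.≡-Reasoning
    g = (g₁ , g₂ , g₃)
    Y-resp = graph-resp fY-cong Y-graph
    fY-comm : ∀ a₁ a₂ → fY (- a₁ + g₁) (- a₂ + g₂) ≈ fY (g₁ - a₁) (g₂ - a₂)
    fY-comm a₁ a₂ = fY-cong (+-comm _ _) (+-comm _ _)
    to : ∀ a₁ a₂ → let A = fX a₁ a₂ in
         - A + a₁ * a₂ + g₃ + - a₁ * g₂ ≈ fY (- a₁ + g₁) (- a₂ + g₂) →
         A + fY (g₁ - a₁) (g₂ - a₂) + a₁ * (g₂ - a₂) ≈ g₃
    to a₁ a₂ p = trans (+-congʳ (+-congˡ (trans (sym (fY-comm a₁ a₂)) (sym p))))
      (solve 5 (λ A a₁ a₂ g₂ g₃ → A :+ (:- A :+ a₁ :* a₂ :+ g₃ :+ :- a₁ :* g₂) :+ a₁ :* (g₂ :- a₂) := g₃)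
         refl (fX a₁ a₂) a₁ a₂ g₂ g₃)
    from : ∀ a₁ a₂ → let A = fX a₁ a₂ in
           A + fY (g₁ - a₁) (g₂ - a₂) + a₁ * (g₂ - a₂) ≈ g₃ →
           - A + a₁ * a₂ + g₃ + - a₁ * g₂ ≈ fY (- a₁ + g₁) (- a₂ + g₂)
    from a₁ a₂ p = trans (+-congʳ (+-congˡ (sym p)))
      (trans (solve 6 (λ A u a₁ a₂ g₂ g₃ → :- A :+ a₁ :* a₂ :+ (A :+ u :+ a₁ :* (g₂ :- a₂)) :+ :- a₁ :* g₂ := u)
                refl (fX a₁ a₂) (fY (g₁ - a₁) (g₂ - a₂)) a₁ a₂ g₂ g₃)
             (sym (fY-comm a₁ a₂)))

  elemsG-complete : ∀ g → Any (g ≈G_) elemsG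
  elemsG-complete (x , y , z) =
    Any.concatMap⁺ _ (Any.map (λ x≈ → Any.concatMap⁺ _ (Any.map (λ y≈ →
      Any.map⁺ (Any.map (λ z≈ → x≈ , y≈ , z≈) (complete z))) (complete y))) (complete x))

  commute⇒ : ∀ {x y z x′ y′ z′} → (x , y , z) · (x′ , y′ , z′) ≈G (x′ , y′ , z′) · (x , y , z) → x * y′ ≈ x′ * y
  commute⇒ {x} {y} {z} {x′} {y′} {z′} (_ , _ , p) = +-cancelˡ (z + z′) _ _ (trans p (+-congʳ (+-comm z′ z)))

  Zc-char : ∀ x y z → Zc (x , y , z) ≡ ((x == 0#) ∧ (y == 0#))
  Zc-char x y z = bool-ext central⇒ ⇒central
    where
    commutes : G → Bool
    commutes h = ((x , y , z) · h) =G (h · (x , y , z))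
    central⇒ : Zc (x , y , z) ≡ true → ((x == 0#) ∧ (y == 0#)) ≡ true
    central⇒ e = ∧-true⁺ (≈⇒== x≈0) (≈⇒== y≈0)
      where
      at : ∀ h → x * proj₁ (proj₂ h) ≈ proj₁ h * y
      at h with All.lookupAny (allL⁻ elemsG commutes e) (elemsG-complete h)
      ... | c , h≈ = let (p₁ , p₂ , _) = h≈ in
        trans (*-congˡ p₂) (trans (commute⇒ (=G⇒≈G c)) (*-congʳ (sym p₁)))
      x≈0 : x ≈ 0#
      x≈0 = trans (sym (*-identityʳ x)) (trans (at (0# , 1# , 0#)) (zeroˡ y))
      y≈0 : y ≈ 0#
      y≈0 = trans (sym (*-identityˡ y)) (trans (sym (at (1# , 0# , 0#))) (zeroʳ x))
    ⇒central : ((x == 0#) ∧ (y == 0#)) ≡ true → Zc (x , y , z) ≡ true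
    ⇒central e with ∧-true⁻ (x == 0#) e
    ... | x0 , y0 = allL⁺ elemsG commutes λ (x′ , y′ , z′) → ≈G⇒=G
      ( +-comm x x′ , +-comm y y′
      , +-cong (+-comm z z′) (trans (*-congʳ (==⇒≈ x0)) (trans (zeroˡ y′) (sym (trans (*-congˡ (==⇒≈ y0)) (zeroʳ x′))))))

  Zc-resp : Zc Preserves _≈G_ ⟶ _≡_
  Zc-resp {x , y , z} {x′ , y′ , z′} (p , q , _) =
    ≡.trans (Zc-char x y z) (≡.trans (cong₂ _∧_ (==-cong p refl) (==-cong q refl)) (≡.sym (Zc-char x′ y′ z′)))

  size-G : size (λ _ → true) ≡ q *ℕ (q *ℕ q)
  size-G = ≡.trans (count-elemsG (λ _ → true))
    (≡.trans (∑-cong (λ _ → ≡.trans (∑-cong (λ _ → ∑-1)) (∑-const q))) (∑-const (q *ℕ q)))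

  size-Zc : size Zc ≡ q
  size-Zc = begin
    size Zc                                                  ≡⟨ count-elemsG Zc ⟩
    ∑G (λ g → ⟦ Zc g ⟧ᵇ)                                     ≡⟨ ∑G-cong (λ (x , y , z) → cong ⟦_⟧ᵇ (Zc-char x y z)) ⟩
    ∑₂ (λ x y → ∑ (λ _ → ⟦ (x , y) ==₂ (0# , 0#) ⟧ᵇ))        ≡⟨ ∑₂-cong (λ x y → ≡.trans (∑-const _) (ℕ.*-comm q _)) ⟩
    ∑₂ (λ x y → ⟦ (x , y) ==₂ (0# , 0#) ⟧ᵇ *ℕ q)             ≡⟨ ∑₂-δ (0# , 0#) (λ _ → q) (λ _ → ≡.refl) ⟩
    q                                                        ∎
    where open ≡.≡-Reasoning

  size-graph : ∀ {X f} → IsGraphOf X f → size X ≡ q *ℕ q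
  size-graph {X} X-graph = begin
    size X                              ≡⟨ count-elemsG X ⟩
    ∑G (λ g → ⟦ X g ⟧ᵇ)                 ≡⟨ ∑G-cong (λ g → cong ⟦_⟧ᵇ (≡.sym (∧-identityʳ (X g)))) ⟩
    ∑G (λ g → ⟦ X g ∧ true ⟧ᵇ)          ≡⟨ ∑G-graph X-graph (λ _ → true) (λ _ → ≡.refl) ⟩
    ∑₂ (λ _ _ → 1)                      ≡⟨ ≡.trans (∑-cong (λ _ → ∑-1)) (∑-const q) ⟩
    q *ℕ q                              ∎
    where open ≡.≡-Reasoning

  graph-semiregular : ∀ {X f} → IsGraphOf X f → Semiregular X Zc
  graph-semiregular {X} {f} X-graph g@(g₁ , g₂ , g₃) = begin
    count elemsG (λ h → X h ∧ Zc (h · inv g))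
      ≡⟨ count-elemsG _ ⟩
    ∑G (λ h → ⟦ X h ∧ Zc (h · inv g) ⟧ᵇ)
      ≡⟨ ∑G-graph X-graph (λ h → Zc (h · inv g)) (λ p → Zc-resp (·-cong p ≈G-refl)) ⟩
    ∑₂ (λ a₁ a₂ → ⟦ Zc ((a₁ , a₂ , f a₁ a₂) · inv g) ⟧ᵇ)
      ≡⟨ ∑₂-cong (λ a₁ a₂ → ≡.trans (cong ⟦_⟧ᵇ (≡.trans (Zc-char _ _ _) (cong₂ _∧_ (diff≈0 a₁ g₁) (diff≈0 a₂ g₂))))
                                    (≡.sym (ℕ.*-identityʳ _))) ⟩
    ∑₂ (λ a₁ a₂ → ⟦ (a₁ , a₂) ==₂ (g₁ , g₂) ⟧ᵇ *ℕ 1)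
      ≡⟨ ∑₂-δ (g₁ , g₂) (λ _ → 1) (λ _ → ≡.refl) ⟩
    1 ∎
    where
    open ≡.≡-Reasoning
    diff≈0 : ∀ a b → ((a - b) == 0#) ≡ (a == b)
    diff≈0 a b = ==-cong-⇔ (x∙y⁻¹≈ε⇒x≈y a b) x≈y⇒x∙y⁻¹≈ε

module NormForm (F : FiniteField) (odd : FiniteField.OddChar F)
                (ε : FiniteField.Carrier F) (ε-nonsquare : FiniteField.IsNonsquare F ε) where

  open FiniteField F
  open FiniteFieldProperties F
  open FiniteFieldSums F
  open IntegerCoefficientSolver ring

  ε≉0 : ¬ ε ≈ 0#
  ε≉0 ε≈0 = ε-nonsquare 0# (trans (zeroˡ 0#) (sym ε≈0))

  nonsquare-*-square : ∀ {c} → ¬ c ≈ 0# → IsNonsquare (ε * (c * c))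
  nonsquare-*-square {c} c≉0 y yy≈εcc = ε-nonsquare (y * recip c) (begin
    (y * recip c) * (y * recip c)            ≈⟨ solve 2 (λ y r → (y :* r) :* (y :* r) := (y :* y) :* (r :* r)) refl y (recip c) ⟩
    (y * y) * (recip c * recip c)            ≈⟨ *-congʳ yy≈εcc ⟩
    (ε * (c * c)) * (recip c * recip c)      ≈⟨ solve 3 (λ e c r → (e :* (c :* c)) :* (r :* r) := e :* ((c :* r) :* (c :* r))) refl ε c (recip c) ⟩
    ε * ((c * recip c) * (c * recip c))      ≈⟨ *-congˡ (*-cong (recip-inverseʳ c≉0) (recip-inverseʳ c≉0)) ⟩
    ε * (1# * 1#)                            ≈⟨ trans (*-congˡ (*-identityʳ 1#)) (*-identityʳ ε) ⟩
    ε                                        ∎)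
    where open ≈-Reasoning

  N : Carrier → Carrier → Carrier
  N a b = a * a - ε * (b * b)

  N-cong : N Preserves₂ _≈_ ⟶ _≈_ ⟶ _≈_
  N-cong p q = +-cong (*-cong p p) (-‿cong (*-congˡ (*-cong q q)))

  N-0 : N 0# 0# ≈ 0#
  N-0 = solve 1 (λ e → con (+ 0) :* con (+ 0) :- e :* (con (+ 0) :* con (+ 0)) := con (+ 0)) refl ε

  N-anisotropic : ∀ {a b} → N a b ≈ 0# → a ≈ 0# × b ≈ 0#
  N-anisotropic {a} {b} Nab≈0 with b ≟ 0#
  ... | no b≉0 = ⊥-elim (ε-nonsquare (a * recip b) (begin
    (a * recip b) * (a * recip b)         ≈⟨ solve 3 (λ a b r → (a :* r) :* (a :* r) := (a :* a) :* (r :* r)) refl a b (recip b) ⟩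
    (a * a) * (recip b * recip b)         ≈⟨ *-congʳ aa≈εbb ⟩
    (ε * (b * b)) * (recip b * recip b)   ≈⟨ solve 3 (λ e b r → (e :* (b :* b)) :* (r :* r) := e :* ((b :* r) :* (b :* r))) refl ε b (recip b) ⟩
    ε * ((b * recip b) * (b * recip b))   ≈⟨ *-congˡ (*-cong (recip-inverseʳ b≉0) (recip-inverseʳ b≉0)) ⟩
    ε * (1# * 1#)                         ≈⟨ trans (*-congˡ (*-identityʳ 1#)) (*-identityʳ ε) ⟩
    ε                                     ∎))
    where
    open ≈-Reasoning
    aa≈εbb : a * a ≈ ε * (b * b)
    aa≈εbb = x∙y⁻¹≈ε⇒x≈y _ _ Nab≈0
  ... | yes b≈0 = square-≈0 (begin
    a * a                ≈⟨ x∙y⁻¹≈ε⇒x≈y _ _ Nab≈0 ⟩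
    ε * (b * b)          ≈⟨ *-congˡ (*-cong b≈0 b≈0) ⟩
    ε * (0# * 0#)        ≈⟨ solve 1 (λ e → e :* (con (+ 0) :* con (+ 0)) := con (+ 0)) refl ε ⟩
    0#                   ∎) , b≈0
    where open ≈-Reasoning

  isSquare : Carrier → Bool
  isSquare t = anyL elems (λ a → (a * a) == t)

  isSquare-resp : isSquare Preserves _≈_ ⟶ _≡_
  isSquare-resp p = anyL-cong elems (λ a → ==-cong refl p)

  isSquare⁺ : ∀ {a t} → a * a ≈ t → isSquare t ≡ true
  isSquare⁺ {a} aa≈t = anyL⁺ elems _ (Any.map (λ a≈b → ≈⇒== (trans (*-cong (sym a≈b) (sym a≈b)) aa≈t)) (complete a))

  isSquare⁻ : ∀ {t} → isSquare t ≡ true → ∃ λ a → a * a ≈ t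
  isSquare⁻ e with anyL⁻ elems _ e
  ... | a , aa==t = a , ==⇒≈ aa==t

  roots+δ : ∀ t → ∑ (λ a → ⟦ (a * a) == t ⟧ᵇ) +ℕ ⟦ t == 0# ⟧ᵇ ≡ 2 *ℕ ⟦ isSquare t ⟧ᵇ
  roots+δ t with t ≟ 0#
  ... | yes t≈0 = begin
    ∑ (λ a → ⟦ (a * a) == t ⟧ᵇ) +ℕ 1   ≡⟨ cong (_+ℕ 1) (∑-unique 0# (λ a → (a * a) == t) (λ p → ==-cong (*-cong p p) refl)
                                                  (λ a aa==t → square-≈0 (trans (==⇒≈ aa==t) t≈0))) ⟩
    ⟦ (0# * 0#) == t ⟧ᵇ +ℕ 1           ≡⟨ cong (λ b → ⟦ b ⟧ᵇ +ℕ 1) (≈⇒== 0·0≈t) ⟩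
    2                                  ≡⟨ cong (λ b → 2 *ℕ ⟦ b ⟧ᵇ) (isSquare⁺ 0·0≈t) ⟨
    2 *ℕ ⟦ isSquare t ⟧ᵇ               ∎
    where
    open ≡.≡-Reasoning
    0·0≈t = trans (zeroˡ 0#) (sym t≈0)
  ... | no t≉0 with isSquare t in sq
  ...   | false = ≡.trans (cong (_+ℕ 0) (∑-cong no-root)) (cong (_+ℕ 0) (≡.trans (∑-const 0) (ℕ.*-zeroʳ q)))
    where
    no-root : ∀ a → ⟦ (a * a) == t ⟧ᵇ ≡ 0
    no-root a with (a * a) ≟ t
    ... | no _ = ≡.refl
    ... | yes aa≈t with ≡.trans (≡.sym (isSquare⁺ aa≈t)) sq
    ...   | ()
  ...   | true with isSquare⁻ sq
  ...     | a₀ , a₀a₀≈t = ≡.trans (cong (_+ℕ 0) (≡.trans (∑-cong two-roots)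
                           (≡.trans (sumOver-+ elems _ _) (cong₂ _+ℕ_ (∑-δ a₀) (∑-δ (- a₀)))))) ≡.refl
    where
    a₀≉-a₀ : ¬ a₀ ≈ - a₀
    a₀≉-a₀ a₀≈-a₀ = t≉0 (trans (sym a₀a₀≈t) (trans (*-congʳ a₀≈0) (zeroˡ a₀)))
      where
      a₀≈0 : a₀ ≈ 0#
      a₀≈0 = *-cancelˡ-≈0 odd (trans (solve 1 (λ x → con (+ 2) :* x := x :+ x) refl a₀)
                                     (trans (+-congˡ a₀≈-a₀) (-‿inverseʳ a₀)))
    two-roots : ∀ a → ⟦ (a * a) == t ⟧ᵇ ≡ ⟦ a == a₀ ⟧ᵇ +ℕ ⟦ a == (- a₀) ⟧ᵇ
    two-roots a with a ≟ a₀ | a ≟ (- a₀)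
    ... | yes p | yes p′ = ⊥-elim (a₀≉-a₀ (trans (sym p) p′))
    ... | yes p | no _   = cong ⟦_⟧ᵇ (≈⇒== (trans (*-cong p p) a₀a₀≈t))
    ... | no _  | yes p′ = cong ⟦_⟧ᵇ (≈⇒== (trans (*-cong p′ p′) (trans (solve 1 (λ x → (:- x) :* (:- x) := x :* x) refl a₀) a₀a₀≈t)))
    ... | no ¬p | no ¬p′ = cong ⟦_⟧ᵇ (≉⇒== (λ aa≈t → [ ¬p , ¬p′ ]′ (square-roots (trans aa≈t (sym a₀a₀≈t)))))

  squares+squares : ∑ (λ t → ⟦ isSquare t ⟧ᵇ) +ℕ ∑ (λ t → ⟦ isSquare t ⟧ᵇ) ≡ suc q
  squares+squares = begin
    ∑ sq +ℕ ∑ sq                                                     ≡⟨ sumOver-+ elems sq sq ⟨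
    ∑ (λ t → sq t +ℕ sq t)                                           ≡⟨ ∑-cong (λ t → cong (sq t +ℕ_) (ℕ.+-identityʳ (sq t))) ⟨
    ∑ (λ t → 2 *ℕ sq t)                                              ≡⟨ ∑-cong roots+δ ⟨
    ∑ (λ t → ∑ (λ a → ⟦ (a * a) == t ⟧ᵇ) +ℕ ⟦ t == 0# ⟧ᵇ)             ≡⟨ sumOver-+ elems _ _ ⟩
    ∑ (λ t → ∑ (λ a → ⟦ (a * a) == t ⟧ᵇ)) +ℕ ∑ (λ t → ⟦ t == 0# ⟧ᵇ)  ≡⟨ cong₂ _+ℕ_ total (∑-δ 0#) ⟩
    q +ℕ 1                                                           ≡⟨ ℕ.+-comm q 1 ⟩
    suc q                                                            ∎
    where
    open ≡.≡-Reasoning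
    sq = λ t → ⟦ isSquare t ⟧ᵇ
    total : ∑ (λ t → ∑ (λ a → ⟦ (a * a) == t ⟧ᵇ)) ≡ q
    total = ≡.trans (∑-swap _) (≡.trans (∑-cong (λ a → ≡.trans (∑-cong (λ t → cong ⟦_⟧ᵇ (==-sym (a * a) t))) (∑-δ (a * a)))) ∑-1)

  N-surjective : ∀ {T} → ¬ T ≈ 0# → ∃₂ λ a b → N a b ≈ T
  N-surjective {T} T≉0 with pigeonhole elems isSquare shifted more-than-q
    where
    shifted : Carrier → Bool
    shifted t = isSquare (recip ε * t - recip ε * T)
    more-than-q : length elems ℕ.< ∑ (λ t → ⟦ isSquare t ⟧ᵇ) +ℕ ∑ (λ t → ⟦ shifted t ⟧ᵇ)
    more-than-q = ℕ.≤-reflexive (≡.sym (≡.trans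
      (cong (∑ (λ t → ⟦ isSquare t ⟧ᵇ) +ℕ_)
            (∑-affine (- (recip ε * T)) (recip-≉0 ε≉0) (⟦_⟧ᵇ ∘ isSquare) (cong ⟦_⟧ᵇ ∘ isSquare-resp)))
      squares+squares))
  ... | t , both with ∧-true⁻ (isSquare t) both
  ... | t-sq , shifted-sq with isSquare⁻ t-sq | isSquare⁻ shifted-sq
  ... | a , aa≈t | b , bb≈shifted = a , b , (begin
    a * a - ε * (b * b)                             ≈⟨ +-cong aa≈t (-‿cong (*-congˡ bb≈shifted)) ⟩
    t - ε * (recip ε * t - recip ε * T)             ≈⟨ solve 4 (λ t T e r → t :- e :* (r :* t :- r :* T) := t :- (e :* r) :* (t :- T)) refl t T ε (recip ε) ⟩
    t - (ε * recip ε) * (t - T)                     ≈⟨ +-congˡ (-‿cong (*-congʳ (recip-inverseʳ ε≉0))) ⟩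
    t - 1# * (t - T)                                ≈⟨ solve 2 (λ t T → t :- con (+ 1) :* (t :- T) := T) refl t T ⟩
    T                                               ∎)
    where open ≈-Reasoning

  -- Multiplication in F(√ε), in the coordinates (a , b) ↦ a + b √ε.
  infixl 7 _⊗_

  _⊗_ : Carrier × Carrier → Carrier × Carrier → Carrier × Carrier
  (γ₁ , γ₂) ⊗ (a , b) = (γ₁ * a + ε * (γ₂ * b) , γ₂ * a + γ₁ * b)

  N-⊗ : ∀ γ x → uncurry N (γ ⊗ x) ≈ uncurry N γ * uncurry N x
  N-⊗ (γ₁ , γ₂) (a , b) = solve 5 (λ g₁ g₂ e a b →
      (g₁ :* a :+ e :* (g₂ :* b)) :* (g₁ :* a :+ e :* (g₂ :* b)) :- e :* ((g₂ :* a :+ g₁ :* b) :* (g₂ :* a :+ g₁ :* b))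
    := (g₁ :* g₁ :- e :* (g₂ :* g₂)) :* (a :* a :- e :* (b :* b))) refl γ₁ γ₂ ε a b

  ⊗-congʳ : ∀ γ → (γ ⊗_) Preserves _≈₂_ ⟶ _≈₂_
  ⊗-congʳ γ (p , q) = +-cong (*-congˡ p) (*-congˡ (*-congˡ q)) , +-cong (*-congˡ p) (*-congˡ q)

  recip⊗ : Carrier → Carrier → Carrier × Carrier
  recip⊗ γ₁ γ₂ = (recip (N γ₁ γ₂) * γ₁ , - (recip (N γ₁ γ₂) * γ₂))

  ⊗-inverseˡ : ∀ γ₁ γ₂ (Nγ≉0 : ¬ N γ₁ γ₂ ≈ 0#) x → recip⊗ γ₁ γ₂ ⊗ ((γ₁ , γ₂) ⊗ x) ≈₂ x
  ⊗-inverseˡ γ₁ γ₂ Nγ≉0 (a , b) =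
      trans (solve 6 (λ r g₁ g₂ e a b → r :* g₁ :* (g₁ :* a :+ e :* (g₂ :* b)) :+ e :* (:- (r :* g₂) :* (g₂ :* a :+ g₁ :* b))
                                      := (r :* (g₁ :* g₁ :- e :* (g₂ :* g₂))) :* a) refl r γ₁ γ₂ ε a b) (one a)
    , trans (solve 6 (λ r g₁ g₂ e a b → :- (r :* g₂) :* (g₁ :* a :+ e :* (g₂ :* b)) :+ r :* g₁ :* (g₂ :* a :+ g₁ :* b)
                                      := (r :* (g₁ :* g₁ :- e :* (g₂ :* g₂))) :* b) refl r γ₁ γ₂ ε a b) (one b)
    where
    r = recip (N γ₁ γ₂)
    one : ∀ x → (r * N γ₁ γ₂) * x ≈ x
    one x = trans (*-congʳ (recip-inverseˡ Nγ≉0)) (*-identityˡ x)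

  ⊗-inverseʳ : ∀ γ₁ γ₂ (Nγ≉0 : ¬ N γ₁ γ₂ ≈ 0#) x → (γ₁ , γ₂) ⊗ (recip⊗ γ₁ γ₂ ⊗ x) ≈₂ x
  ⊗-inverseʳ γ₁ γ₂ Nγ≉0 (a , b) =
      trans (solve 6 (λ r g₁ g₂ e a b → g₁ :* (r :* g₁ :* a :+ e :* (:- (r :* g₂) :* b)) :+ e :* (g₂ :* (:- (r :* g₂) :* a :+ r :* g₁ :* b))
                                      := (r :* (g₁ :* g₁ :- e :* (g₂ :* g₂))) :* a) refl r γ₁ γ₂ ε a b) (one a)
    , trans (solve 6 (λ r g₁ g₂ e a b → g₂ :* (r :* g₁ :* a :+ e :* (:- (r :* g₂) :* b)) :+ g₁ :* (:- (r :* g₂) :* a :+ r :* g₁ :* b)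
                                      := (r :* (g₁ :* g₁ :- e :* (g₂ :* g₂))) :* b) refl r γ₁ γ₂ ε a b) (one b)
    where
    r = recip (N γ₁ γ₂)
    one : ∀ x → (r * N γ₁ γ₂) * x ≈ x
    one x = trans (*-congʳ (recip-inverseˡ Nγ≉0)) (*-identityˡ x)

  normCount : Carrier → ℕ
  normCount T = ∑₂ (λ a b → ⟦ N a b == T ⟧ᵇ)

  normCount-0 : ∀ {T} → T ≈ 0# → normCount T ≡ 1
  normCount-0 {T} T≈0 = ≡.trans (∑₂-cong only-0) (∑₂-δ (0# , 0#) (λ _ → 1) (λ _ → ≡.refl))
    where
    only-0 : ∀ a b → ⟦ N a b == T ⟧ᵇ ≡ ⟦ (a , b) ==₂ (0# , 0#) ⟧ᵇ *ℕ 1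
    only-0 a b = ≡.trans (cong ⟦_⟧ᵇ (bool-ext
      (λ e → let (a≈0 , b≈0) = N-anisotropic (trans (==⇒≈ e) T≈0) in ≈₂⇒==₂ (a≈0 , b≈0))
      (λ e → let (a≈0 , b≈0) = ==₂⇒≈₂ e in
             ≈⇒== (trans (N-cong a≈0 b≈0) (trans N-0 (sym T≈0))))))
      (≡.sym (ℕ.*-identityʳ _))

  normCount-scale : ∀ {T} γ₁ γ₂ → N γ₁ γ₂ ≈ T → ¬ T ≈ 0# → normCount 1# ≡ normCount T
  normCount-scale {T} γ₁ γ₂ Nγ≈T T≉0 = begin
    ∑₂ (λ a b → ⟦ N a b == 1# ⟧ᵇ)    ≡⟨ ∑₂-cong (λ a b → cong ⟦_⟧ᵇ (scale (a , b))) ⟩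
    ∑₂ (λ a b → f (γ ⊗ (a , b)))     ≡⟨ ∑₂-reindex (γ ⊗_) (recip⊗ γ₁ γ₂ ⊗_) (⊗-congʳ γ) (⊗-congʳ _)
                                          (⊗-inverseʳ γ₁ γ₂ Nγ≉0) (⊗-inverseˡ γ₁ γ₂ Nγ≉0)
                                          f (λ (p , q) → cong ⟦_⟧ᵇ (==-cong (N-cong p q) refl)) ⟩
    ∑₂ (λ a b → ⟦ N a b == T ⟧ᵇ)    ∎
    where
    open ≡.≡-Reasoning
    γ = (γ₁ , γ₂)
    f : Carrier × Carrier → ℕ
    f x = ⟦ uncurry N x == T ⟧ᵇ
    Nγ≉0 : ¬ N γ₁ γ₂ ≈ 0#
    Nγ≉0 Nγ≈0 = T≉0 (trans (sym Nγ≈T) Nγ≈0)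
    scale : ∀ x → (uncurry N x == 1#) ≡ (uncurry N (γ ⊗ x) == T)
    scale x = ≡.trans (==-cong-⇔ (λ Nx≈1 → trans (*-congˡ Nx≈1) (*-identityʳ T))
                                (λ TNx≈T → *-cancelˡ T≉0 (trans TNx≈T (sym (*-identityʳ T)))))
                      (==-cong (sym (trans (N-⊗ γ x) (*-congʳ Nγ≈T))) refl)

  normCount-unit : ∀ {T} → ¬ T ≈ 0# → normCount T ≡ normCount 1#
  normCount-unit T≉0 = let (γ₁ , γ₂ , Nγ≈T) = N-surjective T≉0 in ≡.sym (normCount-scale γ₁ γ₂ Nγ≈T T≉0)

  ∑-normCount : ∑ normCount ≡ q *ℕ q
  ∑-normCount = begin
    ∑ (λ T → ∑ (λ a → ∑ (λ b → ⟦ N a b == T ⟧ᵇ)))   ≡⟨ ∑-swap _ ⟩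
    ∑ (λ a → ∑ (λ T → ∑ (λ b → ⟦ N a b == T ⟧ᵇ)))   ≡⟨ ∑-cong (λ a → ∑-swap _) ⟩
    ∑ (λ a → ∑ (λ b → ∑ (λ T → ⟦ N a b == T ⟧ᵇ)))   ≡⟨ ∑-cong (λ a → ∑-cong (λ b → ≡.trans (∑-cong (λ T → cong ⟦_⟧ᵇ (==-sym _ T))) (∑-δ (N a b)))) ⟩
    ∑ (λ a → ∑ (λ b → 1))                           ≡⟨ ≡.trans (∑-cong (λ _ → ∑-1)) (∑-const q) ⟩
    q *ℕ q                                          ∎
    where open ≡.≡-Reasoning

  normCount-1 : normCount 1# ≡ q +ℕ 1
  normCount-1 = n²≡1+[n-1]s⇒s≡n+1 1+#nonzero≡q q≥2 (begin
    q *ℕ q                                                        ≡⟨ ∑-normCount ⟨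
    ∑ normCount                                                   ≡⟨ ∑-cong by-zero ⟩
    ∑ (λ T → ⟦ T == 0# ⟧ᵇ +ℕ ⟦ not (T == 0#) ⟧ᵇ *ℕ normCount 1#)  ≡⟨ sumOver-+ elems _ _ ⟩
    ∑ (λ T → ⟦ T == 0# ⟧ᵇ) +ℕ ∑ (λ T → ⟦ not (T == 0#) ⟧ᵇ *ℕ normCount 1#)
                                                                  ≡⟨ cong₂ _+ℕ_ (∑-δ 0#) (sumOver-*ʳ elems (normCount 1#) _) ⟩
    1 +ℕ ∑ (λ T → ⟦ not (T == 0#) ⟧ᵇ) *ℕ normCount 1#             ∎)
    where
    open ≡.≡-Reasoning
    by-zero : ∀ T → normCount T ≡ ⟦ T == 0# ⟧ᵇ +ℕ ⟦ not (T == 0#) ⟧ᵇ *ℕ normCount 1#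
    by-zero T with T ≟ 0#
    ... | yes T≈0 = normCount-0 T≈0
    ... | no T≉0  = ≡.trans (normCount-unit T≉0) (≡.sym (ℕ.+-identityʳ _))

  normCount-formula : ∀ T → normCount T ≡ (if T == 0# then 1 else q +ℕ 1)
  normCount-formula T with T ≟ 0#
  ... | yes T≈0 = normCount-0 T≈0
  ... | no T≉0  = ≡.trans (normCount-unit T≉0) normCount-1

  4ε²s≉0 : ∀ {s} → ¬ s ≈ 0# → ¬ two * two * ε * ε * s ≈ 0#
  4ε²s≉0 s≉0 = *-≉0 (*-≉0 (*-≉0 (*-≉0 odd odd) ε≉0) ε≉0) s≉0

  complete-square : ∀ s La Lb C a b →
    (two * two * ε * ε * s) * (s * N a b + La * a + Lb * b + C)
      ≈ N (two * ε * s * a + ε * La) (two * ε * s * b - Lb) + ((two * two * ε * ε * s) * C - N (ε * La) Lb)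
  complete-square s La Lb C a b = solve 7 (λ s La Lb C e a b →
      (con (+ 2) :* con (+ 2) :* e :* e :* s) :* (s :* (a :* a :- e :* (b :* b)) :+ La :* a :+ Lb :* b :+ C)
    := ((con (+ 2) :* e :* s :* a :+ e :* La) :* (con (+ 2) :* e :* s :* a :+ e :* La)
          :- e :* ((con (+ 2) :* e :* s :* b :- Lb) :* (con (+ 2) :* e :* s :* b :- Lb)))
       :+ ((con (+ 2) :* con (+ 2) :* e :* e :* s) :* C :- ((e :* La) :* (e :* La) :- e :* (Lb :* Lb)))) refl s La Lb C ε a b

  quadratic⇔norm : ∀ {s} La Lb C c a b → ¬ s ≈ 0# →
    (s * N a b + La * a + Lb * b + C ≈ c) ⇔
    (N (two * ε * s * a + ε * La) (two * ε * s * b - Lb) ≈ (two * two * ε * ε * s) * (c - C) + N (ε * La) Lb)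
  quadratic⇔norm {s} La Lb C c a b s≉0 = mk⇔ to from
    where
    open ≈-Reasoning
    μ K : Carrier
    μ = two * two * ε * ε * s
    K = μ * C - N (ε * La) Lb
    μc-K : μ * c - K ≈ μ * (c - C) + N (ε * La) Lb
    μc-K = solve 4 (λ μ c C M → μ :* c :- (μ :* C :- M) := μ :* (c :- C) :+ M) refl μ c C (N (ε * La) Lb)
    to : s * N a b + La * a + Lb * b + C ≈ c → _
    to E≈c = begin
      N (two * ε * s * a + ε * La) (two * ε * s * b - Lb)          ≈⟨ solve 2 (λ n K → n := (n :+ K) :- K) refl _ K ⟩
      N (two * ε * s * a + ε * La) (two * ε * s * b - Lb) + K - K  ≈⟨ +-congʳ (complete-square s La Lb C a b) ⟨
      μ * (s * N a b + La * a + Lb * b + C) - K                    ≈⟨ +-congʳ (*-congˡ E≈c) ⟩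
      μ * c - K                                                    ≈⟨ μc-K ⟩
      μ * (c - C) + N (ε * La) Lb                                  ∎
    from : N (two * ε * s * a + ε * La) (two * ε * s * b - Lb) ≈ μ * (c - C) + N (ε * La) Lb →
           s * N a b + La * a + Lb * b + C ≈ c
    from n≈T = *-cancelˡ (4ε²s≉0 s≉0) (begin
      μ * (s * N a b + La * a + Lb * b + C)                        ≈⟨ complete-square s La Lb C a b ⟩
      N (two * ε * s * a + ε * La) (two * ε * s * b - Lb) + K      ≈⟨ +-congʳ (trans n≈T (sym μc-K)) ⟩
      μ * c - K + K                                                ≈⟨ solve 2 (λ x K → x :- K :+ K := x) refl (μ * c) K ⟩
      μ * c                                                        ∎)

  ∑₂-quadratic : ∀ {s} La Lb C c → ¬ s ≈ 0# →
    ∑₂ (λ a b → ⟦ (s * N a b + La * a + Lb * b + C) == c ⟧ᵇ)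
      ≡ normCount ((two * two * ε * ε * s) * (c - C) + N (ε * La) Lb)
  ∑₂-quadratic {s} La Lb C c s≉0 = begin
    ∑₂ (λ a b → ⟦ (s * N a b + La * a + Lb * b + C) == c ⟧ᵇ)
      ≡⟨ ∑₂-cong (λ a b → cong ⟦_⟧ᵇ (==-cong-⇔ (Equivalence.to (quadratic⇔norm La Lb C c a b s≉0))
                                                     (Equivalence.from (quadratic⇔norm La Lb C c a b s≉0)))) ⟩
    ∑₂ (λ a b → ⟦ N (α * a + ε * La) (α * b - Lb) == T ⟧ᵇ)
      ≡⟨ ∑-cong (λ a → ∑-affine (- Lb) α≉0 (λ b′ → ⟦ N (α * a + ε * La) b′ == T ⟧ᵇ)
                         (λ p → cong ⟦_⟧ᵇ (==-cong (N-cong refl p) refl))) ⟩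
    ∑₂ (λ a b → ⟦ N (α * a + ε * La) b == T ⟧ᵇ)
      ≡⟨ ∑-affine (ε * La) α≉0 (λ a′ → ∑ (λ b → ⟦ N a′ b == T ⟧ᵇ))
                  (λ p → ∑-cong (λ b → cong ⟦_⟧ᵇ (==-cong (N-cong p refl) refl))) ⟩
    normCount T ∎
    where
    open ≡.≡-Reasoning
    α T : Carrier
    α = two * ε * s
    T = (two * two * ε * ε * s) * (c - C) + N (ε * La) Lb
    α≉0 : ¬ α ≈ 0#
    α≉0 = *-≉0 (*-≉0 odd ε≉0) s≉0

module LinkedSystem (F : FiniteField) (odd : FiniteField.OddChar F)
                   (ε : FiniteField.Carrier F) (ε-nonsquare : FiniteField.IsNonsquare F ε) where

  open FiniteField F
  open Heisenberg F
  open FiniteFieldProperties F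
  open FiniteFieldSums F
  open HeisenbergCounting F
  open NormForm F odd ε ε-nonsquare
  open IntegerCoefficientSolver ring

  h : Carrier
  h = recip two

  two*h : two * h ≈ 1#
  two*h = recip-inverseʳ odd

  h+h : h + h ≈ 1#
  h+h = trans (solve 1 (λ h → h :+ h := con (+ 2) :* h) refl h) two*h

  f : Carrier → Carrier → Carrier → Carrier
  f i a b = a * b * h + N a b * i

  f-cong : ∀ i → f i Preserves₂ _≈_ ⟶ _≈_ ⟶ _≈_
  f-cong i p q = +-cong (*-congʳ (*-cong p q)) (*-congʳ (N-cong p q))

  X : Carrier → Subset
  X i = Xset ε h i

  φ-base : ∀ α β i → φ ε h α β (1# , 0# , i) ≈G (α , β , f i α β)
  φ-base α β i =
      solve 3 (λ α β e → α :* con (+ 1) :+ e :* β :* con (+ 0) := α) refl α β ε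
    , solve 2 (λ α β → β :* con (+ 1) :+ α :* con (+ 0) := β) refl α β
    , solve 5 (λ α β i h e →
        α :* β :* (con (+ 1) :* con (+ 1) :* h :+ e :* (con (+ 0) :* con (+ 0) :* h)) :+ e :* (β :* β) :* (con (+ 1) :* con (+ 0))
          :+ (α :* α :- e :* (β :* β)) :* i
        := α :* β :* h :+ (α :* α :- e :* (β :* β)) :* i) refl α β i h ε

  f-0 : ∀ i → f i 0# 0# ≈ 0#
  f-0 i = solve 3 (λ i h e → con (+ 0) :* con (+ 0) :* h :+ (con (+ 0) :* con (+ 0) :- e :* (con (+ 0) :* con (+ 0))) :* i := con (+ 0))
            refl i h ε

  X-graph : ∀ i → IsGraphOf (X i) (f i)
  X-graph i x y z = bool-ext member⇒ ⇒member
    where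
    member⇒ : X i (x , y , z) ≡ true → (z == f i x y) ≡ true
    member⇒ e with ∨-true⁻ (Yorb ε h i (x , y , z)) e
    ... | inj₂ is-e = let (x≈0 , y≈0 , z≈0) = =G⇒≈G is-e in
      ≈⇒== (trans z≈0 (sym (trans (f-cong i x≈0 y≈0) (f-0 i))))
    ... | inj₁ in-orbit with anyL⁻ elems _ in-orbit
    ...   | α , in-orbit′ with anyL⁻ elems _ in-orbit′
    ...     | β , hit = let (x≈ , y≈ , z≈) = ≈G-trans (≈G-sym (=G⇒≈G (proj₂ (∧-true⁻ (not ((α == 0#) ∧ (β == 0#))) hit)))) (φ-base α β i) in
      ≈⇒== (trans z≈ (f-cong i (sym x≈) (sym y≈)))
    in-orbit : (z == f i x y) ≡ true → ¬ (x ≈ 0# × y ≈ 0#) → Yorb ε h i (x , y , z) ≡ true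
    in-orbit e xy≉0 = anyL⁺ elems _ (Any.map (λ {α} x≈α → anyL⁺ elems _ (Any.map (λ {β} y≈β →
      ∧-true⁺ (not-both x≈α y≈β)
              (≈G⇒=G (≈G-trans (φ-base α β i) (sym x≈α , sym y≈β , sym (trans (==⇒≈ e) (f-cong i x≈α y≈β))))))
      (complete y))) (complete x))
      where
      not-both : ∀ {α β} → x ≈ α → y ≈ β → not ((α == 0#) ∧ (β == 0#)) ≡ true
      not-both {α} {β} x≈α y≈β with α ≟ 0# | β ≟ 0#
      ... | yes α≈0 | yes β≈0 = ⊥-elim (xy≉0 (trans x≈α α≈0 , trans y≈β β≈0))
      ... | yes _   | no _    = ≡.refl
      ... | no _    | _       = ≡.refl
    ⇒member : (z == f i x y) ≡ true → X i (x , y , z) ≡ true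
    ⇒member e with x ≟ 0# | y ≟ 0#
    ... | yes x≈0 | yes y≈0 = ∨-true⁺ʳ (Yorb ε h i (x , y , z))
      (≈⇒== (trans (==⇒≈ e) (trans (f-cong i x≈0 y≈0) (f-0 i))))
    ... | no x≉0 | _ = ∨-true⁺ˡ _ (in-orbit e λ (x≈0 , _) → x≉0 x≈0)
    ... | _ | no y≉0 = ∨-true⁺ˡ _ (in-orbit e λ (_ , y≈0) → y≉0 y≈0)

  L₁ L₂ C₀ : Carrier → Carrier → Carrier → Carrier
  L₁ j g₁ g₂ = h * g₂ - (j + j) * g₁
  L₂ j g₁ g₂ = (j + j) * ε * g₂ - h * g₁
  C₀ j g₁ g₂ = h * g₁ * g₂ + N g₁ g₂ * j

  prodCoeff-X≡∑₂ : ∀ i j {Y} → IsGraphOf Y (f j) → ∀ g₁ g₂ g₃ → prodCoeff (X i) Y (g₁ , g₂ , g₃) ≡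
    ∑₂ (λ a b → ⟦ ((i + j) * N a b + L₁ j g₁ g₂ * a + L₂ j g₁ g₂ * b + C₀ j g₁ g₂) == g₃ ⟧ᵇ)
  prodCoeff-X≡∑₂ i j Y-graph g₁ g₂ g₃ = ≡.trans (prodCoeff-graphs (X-graph i) Y-graph (f-cong j) g₁ g₂ g₃)
    (∑₂-cong (λ a b → cong ⟦_⟧ᵇ (==-cong (expand a b) refl)))
    where
    -- a (g₂ - b) is rewritten as (h + h) a (g₂ - b), since 2h = 1 is not a ring identity
    expand : ∀ a b → f i a b + f j (g₁ - a) (g₂ - b) + a * (g₂ - b) ≈
                     (i + j) * N a b + L₁ j g₁ g₂ * a + L₂ j g₁ g₂ * b + C₀ j g₁ g₂
    expand a b = trans (+-congˡ (trans (sym (*-identityˡ _)) (*-congʳ (sym h+h)))) (solve 8 (λ a b g₁ g₂ i j e h →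
         (a :* b :* h :+ (a :* a :- e :* (b :* b)) :* i)
         :+ ((g₁ :- a) :* (g₂ :- b) :* h :+ ((g₁ :- a) :* (g₁ :- a) :- e :* ((g₂ :- b) :* (g₂ :- b))) :* j)
         :+ (h :+ h) :* (a :* (g₂ :- b))
      := (i :+ j) :* (a :* a :- e :* (b :* b)) :+ (h :* g₂ :- (j :+ j) :* g₁) :* a :+ ((j :+ j) :* e :* g₂ :- h :* g₁) :* b
         :+ (h :* g₁ :* g₂ :+ (g₁ :* g₁ :- e :* (g₂ :* g₂)) :* j)) refl a b g₁ g₂ i j ε h)

  L≈0⇒g≈0 : ∀ {j g₁ g₂} → L₁ j g₁ g₂ ≈ 0# → L₂ j g₁ g₂ ≈ 0# → g₁ ≈ 0# × g₂ ≈ 0#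
  L≈0⇒g≈0 {j} {g₁} {g₂} L₁≈0 L₂≈0 = g₁≈0 , trans g₂≈mg₁ (trans (*-congˡ g₁≈0) (zeroʳ m))
    where
    open ≈-Reasoning
    m : Carrier
    m = two * (j + j)
    double : ∀ {x y} → h * x ≈ y → x ≈ two * y
    double {x} {y} hx≈y = begin
      x               ≈⟨ *-identityˡ x ⟨
      1# * x          ≈⟨ *-congʳ two*h ⟨
      two * h * x     ≈⟨ *-assoc two h x ⟩
      two * (h * x)   ≈⟨ *-congˡ hx≈y ⟩
      two * y         ∎
    g₂≈mg₁ : g₂ ≈ m * g₁
    g₂≈mg₁ = trans (double (x∙y⁻¹≈ε⇒x≈y _ _ L₁≈0)) (sym (*-assoc two (j + j) g₁))
    g₁≈mεg₂ : g₁ ≈ m * ε * g₂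
    g₁≈mεg₂ = trans (double (sym (x∙y⁻¹≈ε⇒x≈y _ _ L₂≈0)))
      (solve 4 (λ t j e g → t :* ((j :+ j) :* e :* g) := t :* (j :+ j) :* e :* g) refl two j ε g₂)
    -- otherwise m² ε = 1, so that N(1, m) = 0
    g₁≈0 : g₁ ≈ 0#
    g₁≈0 with g₁ ≟ 0#
    ... | yes g₁≈0 = g₁≈0
    ... | no g₁≉0  = ⊥-elim (1≉0 (proj₁ (N-anisotropic (begin
      1# * 1# - ε * (m * m)     ≈⟨ solve 2 (λ e m → con (+ 1) :* con (+ 1) :- e :* (m :* m) := con (+ 1) :- m :* m :* e) refl ε m ⟩
      1# - m * m * ε            ≈⟨ x≈y⇒x∙y⁻¹≈ε (sym mmε≈1) ⟩
      0#                        ∎))))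
      where
      mmε≈1 : m * m * ε ≈ 1#
      mmε≈1 = *-cancelˡ g₁≉0 (begin
        g₁ * (m * m * ε)   ≈⟨ solve 3 (λ g m e → g :* (m :* m :* e) := m :* e :* (m :* g)) refl g₁ m ε ⟩
        m * ε * (m * g₁)   ≈⟨ *-congˡ g₂≈mg₁ ⟨
        m * ε * g₂         ≈⟨ g₁≈mεg₂ ⟨
        g₁                 ≈⟨ *-identityʳ g₁ ⟨
        g₁ * 1#            ∎)

  prodCoeff-opposite : ∀ {i j Y} → IsGraphOf Y (f j) → i + j ≈ 0# → ∀ g →
    prodCoeff (X i) Y g ≡ (if g =G e then q ^ 2 else 0) +ℕ (if Zc g then 0 else q)
  prodCoeff-opposite {i} {j} {Y} Y-graph i+j≈0 (g₁ , g₂ , g₃) = begin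
    prodCoeff (X i) Y (g₁ , g₂ , g₃)
      ≡⟨ prodCoeff-X≡∑₂ i j Y-graph g₁ g₂ g₃ ⟩
    ∑₂ (λ a b → ⟦ ((i + j) * N a b + ℓ₁ * a + ℓ₂ * b + c₀) == g₃ ⟧ᵇ)
      ≡⟨ ∑₂-cong (λ a b → cong ⟦_⟧ᵇ (==-cong (+-congʳ (+-congʳ (drop-N a b))) refl)) ⟩
    ∑₂ (λ a b → ⟦ (ℓ₁ * a + ℓ₂ * b + c₀) == g₃ ⟧ᵇ)
      ≡⟨ by-cases ⟩
    (if (g₁ == 0#) ∧ (g₂ == 0#) ∧ (g₃ == 0#) then q ^ 2 else 0) +ℕ (if (g₁ == 0#) ∧ (g₂ == 0#) then 0 else q)
      ≡⟨ cong (λ b → (if (g₁ , g₂ , g₃) =G e then q ^ 2 else 0) +ℕ (if b then 0 else q)) (Zc-char g₁ g₂ g₃) ⟨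
    (if (g₁ , g₂ , g₃) =G e then q ^ 2 else 0) +ℕ (if Zc (g₁ , g₂ , g₃) then 0 else q) ∎
    where
    open ≡.≡-Reasoning
    ℓ₁ = L₁ j g₁ g₂
    ℓ₂ = L₂ j g₁ g₂
    c₀ = C₀ j g₁ g₂
    drop-N : ∀ a b → (i + j) * N a b + ℓ₁ * a ≈ ℓ₁ * a
    drop-N a b = trans (+-congʳ (trans (*-congʳ i+j≈0) (zeroˡ _))) (+-identityˡ _)
    q²-or-0 : ∀ b → q *ℕ (q *ℕ ⟦ b ⟧ᵇ) ≡ (if b then q ^ 2 else 0) +ℕ 0
    q²-or-0 true  = ≡.sym (ℕ.+-identityʳ _)
    q²-or-0 false = ≡.trans (cong (q *ℕ_) (ℕ.*-zeroʳ q)) (ℕ.*-zeroʳ q)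
    by-cases : ∑₂ (λ a b → ⟦ (ℓ₁ * a + ℓ₂ * b + c₀) == g₃ ⟧ᵇ) ≡
            (if (g₁ == 0#) ∧ (g₂ == 0#) ∧ (g₃ == 0#) then q ^ 2 else 0) +ℕ (if (g₁ == 0#) ∧ (g₂ == 0#) then 0 else q)
    by-cases with g₁ ≟ 0# | g₂ ≟ 0#
    ... | no g₁≉0 | _       = ∑₂-affine c₀ g₃ (λ (ℓ₁≈0 , ℓ₂≈0) → g₁≉0 (proj₁ (L≈0⇒g≈0 ℓ₁≈0 ℓ₂≈0)))
    ... | yes _   | no g₂≉0 = ∑₂-affine c₀ g₃ (λ (ℓ₁≈0 , ℓ₂≈0) → g₂≉0 (proj₂ (L≈0⇒g≈0 ℓ₁≈0 ℓ₂≈0)))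
    ... | yes g₁≈0 | yes g₂≈0 = begin
      ∑₂ (λ a b → ⟦ (ℓ₁ * a + ℓ₂ * b + c₀) == g₃ ⟧ᵇ)   ≡⟨ ∑₂-constant c₀ g₃ ℓ₁≈0 ℓ₂≈0 ⟩
      q *ℕ (q *ℕ ⟦ c₀ == g₃ ⟧ᵇ)                         ≡⟨ cong (λ b → q *ℕ (q *ℕ ⟦ b ⟧ᵇ)) (≡.trans (==-cong c₀≈0 refl) (==-sym 0# g₃)) ⟩
      q *ℕ (q *ℕ ⟦ g₃ == 0# ⟧ᵇ)                         ≡⟨ q²-or-0 (g₃ == 0#) ⟩
      (if g₃ == 0# then q ^ 2 else 0) +ℕ 0              ∎
      where
      ℓ₁≈0 : ℓ₁ ≈ 0#
      ℓ₁≈0 = trans (+-cong (*-congˡ g₂≈0) (-‿cong (*-congˡ g₁≈0)))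
                   (solve 2 (λ h j → h :* con (+ 0) :- (j :+ j) :* con (+ 0) := con (+ 0)) refl h j)
      ℓ₂≈0 : ℓ₂ ≈ 0#
      ℓ₂≈0 = trans (+-cong (*-congˡ g₂≈0) (-‿cong (*-congˡ g₁≈0)))
                   (solve 3 (λ h j e → (j :+ j) :* e :* con (+ 0) :- h :* con (+ 0) := con (+ 0)) refl h j ε)
      c₀≈0 : c₀ ≈ 0#
      c₀≈0 = trans (+-cong (*-cong (*-congˡ g₁≈0) g₂≈0) (*-congʳ (N-cong g₁≈0 g₂≈0)))
                   (solve 3 (λ h j e → h :* con (+ 0) :* con (+ 0) :+ (con (+ 0) :* con (+ 0) :- e :* (con (+ 0) :* con (+ 0))) :* j := con (+ 0)) refl h j ε)

  h≉0 : ¬ h ≈ 0#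
  h≉0 = recip-≉0 odd

  δ : Carrier
  δ = ε * ((h * h * recip ε) * (h * h * recip ε))

  δ-nonsquare : IsNonsquare δ
  δ-nonsquare = nonsquare-*-square (*-≉0 (*-≉0 h≉0 h≉0) (recip-≉0 ε≉0))

  4ε²δ≈εh² : two * two * ε * ε * δ ≈ ε * h * h
  4ε²δ≈εh² = begin
    two * two * ε * ε * (ε * ((h * h * r) * (h * h * r)))
      ≈⟨ solve 3 (λ h r e → con (+ 2) :* con (+ 2) :* e :* e :* (e :* ((h :* h :* r) :* (h :* h :* r)))
                         := e :* h :* h :* ((con (+ 2) :* h) :* (con (+ 2) :* h)) :* ((e :* r) :* (e :* r))) refl h r ε ⟩
    ε * h * h * ((two * h) * (two * h)) * ((ε * r) * (ε * r))
      ≈⟨ *-cong (*-congˡ (*-cong two*h two*h)) (*-cong (recip-inverseʳ ε≉0) (recip-inverseʳ ε≉0)) ⟩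
    ε * h * h * (1# * 1#) * (1# * 1#)
      ≈⟨ solve 2 (λ e h → e :* h :* h :* (con (+ 1) :* con (+ 1)) :* (con (+ 1) :* con (+ 1)) := e :* h :* h) refl ε h ⟩
    ε * h * h ∎
    where
    open ≈-Reasoning
    r = recip ε

  ψ : Carrier → Carrier → Carrier
  ψ i j = (i * j + δ) * recip (i + j)

  -- For k = ψ i j the last two summands vanish.
  norm-constant : ∀ i j k g₁ g₂ g₃ →
    (two * two * ε * ε * (i + j)) * (g₃ - C₀ j g₁ g₂) + N (ε * L₁ j g₁ g₂) (L₂ j g₁ g₂)
      ≈ (two * two * ε * ε * (i + j)) * (g₃ - f k g₁ g₂)
        + (two * two * ε * ε) * N g₁ g₂ * ((i + j) * k - (i * j + δ)) + N g₁ g₂ * (two * two * ε * ε * δ - ε * h * h)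
  norm-constant i j k g₁ g₂ g₃ = solve 9 (λ i j k d g₁ g₂ g₃ e h →
      (con (+ 2) :* con (+ 2) :* e :* e :* (i :+ j)) :* (g₃ :- (h :* g₁ :* g₂ :+ (g₁ :* g₁ :- e :* (g₂ :* g₂)) :* j))
        :+ ((e :* (h :* g₂ :- (j :+ j) :* g₁)) :* (e :* (h :* g₂ :- (j :+ j) :* g₁))
            :- e :* (((j :+ j) :* e :* g₂ :- h :* g₁) :* ((j :+ j) :* e :* g₂ :- h :* g₁)))
    := (con (+ 2) :* con (+ 2) :* e :* e :* (i :+ j)) :* (g₃ :- (g₁ :* g₂ :* h :+ (g₁ :* g₁ :- e :* (g₂ :* g₂)) :* k))
        :+ (con (+ 2) :* con (+ 2) :* e :* e) :* (g₁ :* g₁ :- e :* (g₂ :* g₂)) :* ((i :+ j) :* k :- (i :* j :+ d))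
        :+ (g₁ :* g₁ :- e :* (g₂ :* g₂)) :* (con (+ 2) :* con (+ 2) :* e :* e :* d :- e :* h :* h))
    refl i j k δ g₁ g₂ g₃ ε h

  prodCoeff-ψ : ∀ i j → ¬ j ≈ - i → ∀ g → prodCoeff (X i) (X j) g ≡ (if X (ψ i j) g then 1 else q +ℕ 1)
  prodCoeff-ψ i j j≉-i (g₁ , g₂ , g₃) = begin
    prodCoeff (X i) (X j) (g₁ , g₂ , g₃)                              ≡⟨ prodCoeff-X≡∑₂ i j (X-graph j) g₁ g₂ g₃ ⟩
    ∑₂ (λ a b → ⟦ ((i + j) * N a b + ℓ₁ * a + ℓ₂ * b + c₀) == g₃ ⟧ᵇ)   ≡⟨ ∑₂-quadratic ℓ₁ ℓ₂ c₀ g₃ s≉0 ⟩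
    normCount T                                                       ≡⟨ normCount-formula T ⟩
    (if T == 0# then 1 else q +ℕ 1)                                   ≡⟨ cong (λ b → if b then 1 else q +ℕ 1) T==0 ⟩
    (if X (ψ i j) (g₁ , g₂ , g₃) then 1 else q +ℕ 1)                  ∎
    where
    open ≡.≡-Reasoning
    s = i + j
    μ = two * two * ε * ε * s
    ℓ₁ = L₁ j g₁ g₂
    ℓ₂ = L₂ j g₁ g₂
    c₀ = C₀ j g₁ g₂
    T = μ * (g₃ - c₀) + N (ε * ℓ₁) ℓ₂
    s≉0 : ¬ s ≈ 0#
    s≉0 s≈0 = j≉-i (trans (solve 2 (λ i j → j := (i :+ j) :- i) refl i j) (trans (+-congʳ s≈0) (+-identityˡ _)))
    sψ≈ : s * ψ i j ≈ i * j + δ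
    sψ≈ = trans (solve 3 (λ s x r → s :* (x :* r) := x :* (s :* r)) refl s (i * j + δ) (recip s))
                (trans (*-congˡ (recip-inverseʳ s≉0)) (*-identityʳ _))
    T≈ : T ≈ μ * (g₃ - f (ψ i j) g₁ g₂)
    T≈ = trans (norm-constant i j (ψ i j) g₁ g₂ g₃)
      (trans (+-cong (+-congˡ (trans (*-congˡ (x≈y⇒x∙y⁻¹≈ε sψ≈)) (zeroʳ _)))
                     (trans (*-congˡ (x≈y⇒x∙y⁻¹≈ε 4ε²δ≈εh²)) (zeroʳ _)))
             (trans (+-identityʳ _) (+-identityʳ _)))
    T==0 : (T == 0#) ≡ X (ψ i j) (g₁ , g₂ , g₃)
    T==0 = ≡.trans (==-cong-⇔
        (λ T≈0 → x∙y⁻¹≈ε⇒x≈y _ _ (*-cancelˡ-≈0 (4ε²s≉0 s≉0) (trans (sym T≈) T≈0)))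
        (λ g₃≈f → trans T≈ (trans (*-congˡ (x≈y⇒x∙y⁻¹≈ε g₃≈f)) (zeroʳ μ))))
      (≡.sym (X-graph (ψ i j) g₁ g₂ g₃))

  f-opposite : ∀ i x y → f i (- x) (- y) + f (- i) x y ≈ x * y
  f-opposite i x y = trans (solve 5 (λ i x y h e →
      (:- x) :* (:- y) :* h :+ ((:- x) :* (:- x) :- e :* ((:- y) :* (:- y))) :* i :+ (x :* y :* h :+ (x :* x :- e :* (y :* y)) :* (:- i))
    := (h :+ h) :* (x :* y)) refl i x y h ε) (trans (*-congʳ h+h) (*-identityˡ _))

  X-inverse : ∀ i → inverseSet (X i) ≐ X (- i)
  X-inverse i (x , y , z) =
    ≡.trans (X-graph i (- x) (- y) (- z + x * y)) (≡.trans (==-cong-⇔ to from) (≡.sym (X-graph (- i) x y z)))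
    where
    open ≈-Reasoning
    A = f i (- x) (- y)
    B = f (- i) x y
    to : - z + x * y ≈ A → z ≈ B
    to p = begin
      z                       ≈⟨ solve 3 (λ z x y → z := x :* y :- (:- z :+ x :* y)) refl z x y ⟩
      x * y - (- z + x * y)   ≈⟨ +-cong (sym (f-opposite i x y)) (-‿cong p) ⟩
      A + B - A               ≈⟨ solve 2 (λ A B → A :+ B :- A := B) refl A B ⟩
      B                       ∎
    from : z ≈ B → - z + x * y ≈ A
    from p = begin
      - z + x * y             ≈⟨ +-cong (-‿cong p) (sym (f-opposite i x y)) ⟩
      - B + (A + B)           ≈⟨ solve 2 (λ A B → :- B :+ (A :+ B) := A) refl A B ⟩
      A                       ∎

  X⁻¹-graph : ∀ i → IsGraphOf (inverseSet (X i)) (f (- i))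
  X⁻¹-graph i x y z = ≡.trans (X-inverse i (x , y , z)) (X-graph (- i) x y z)

  X-isRDS : ∀ i → IsRDS (X i) Zc (q ^ 2) q (q ^ 2) q
  X-isRDS i = ≡.trans (q²*q≡q*[q*q] q) (≡.sym size-G) , size-Zc
            , ≡.trans (size-graph (X-graph i)) (cong (q *ℕ_) (≡.sym (ℕ.*-identityʳ q)))
            , ℕ.<-≤-trans (ℕ.s≤s ℕ.z≤n) q≥2
            , prodCoeff-opposite (X⁻¹-graph i) (-‿inverseʳ i)
    where
    q²*q≡q*[q*q] : ∀ n → n ^ 2 *ℕ n ≡ n *ℕ (n *ℕ n)
    q²*q≡q*[q*q] n = ≡.trans (cong (λ m → n *ℕ m *ℕ n) (ℕ.*-identityʳ n)) (ℕ.*-assoc n n n)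

corollary6p4 : (F : FiniteField) → FiniteField.OddChar F →
    (ε : FiniteField.Carrier F) → FiniteField.IsNonsquare F ε →
    let open FiniteField F
        open Heisenberg F
        q = order
        X : Carrier → Subset
        X i = Xset ε (recip (1# + 1#)) i
    in ∃ λ δ → IsNonsquare δ
         × IsClosedLinkedSystem X Zc (q ^ 2) q (q ^ 2) q q 1 (q +ℕ 1)
             (λ i → - i) (λ i j → (i * j + δ) * recip (i + j))
         × (∀ i → Semiregular (X i) Zc)
corollary6p4 F odd ε ε-nonsquare =
    δ , δ-nonsquare
  , ( ≡.refl , q≥2 , X-isRDS
    , ((λ _ _ → -‿injective) , (λ β → - β , -‿involutive β))
    , X-inverse
    , (λ α β β≈-α → prodCoeff-opposite (X-graph β) (trans (+-congˡ β≈-α) (-‿inverseʳ α)))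
    , prodCoeff-ψ )
  , (λ i → graph-semiregular (X-graph i))
  where
  open FiniteField F
  open FiniteFieldProperties F
  open FiniteFieldSums F using (q≥2)
  open HeisenbergCounting F using (graph-semiregular)
  open LinkedSystem F odd ε ε-nonsquare
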